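{- Let $\alpha=10^5$. Let $G$ be a $d$-regular graph on $[n]$ with properties (P1) and (P2), and let $c:[n]\to\mathcal{C}$ be a vertex coloring with $|\mathcal{C}|=\left(1-\frac{\alpha\log d}{d}\right)n$ colors. For sufficiently large $d$ and $n$, there exist two disjoint $G$-dense sets $V_1,V_2\subset[n]$ which have the same coloring.
   Context: (P1): every vertex set $U$ with $|U|\le\frac{30\log d}{d}n$ satisfies $e_G(U)\le100|U|\log d$. (P2): for any two disjoint vertex sets $T,U$ with $|T|\ge\frac{10\log d}{d}n$ and $|U|\ge\frac{100\log d}{d}n$, $e_G(T,U)\ge|T||U|\frac{d}{20n}$. Here $e_G(U)$ is the number of edges inside $U$ and $e_G(T,U)$ the number of edges between $T$ and $U$. With $\alpha=10^5$, a set $V_1\subset[n]$ is $G$-dense if $\frac{\alpha\log d}{4d}n\le|V_1|\le\frac{\alpha\log d}{2d}n$ and every $v\in V_1$ has at least $\frac{\alpha}{160}\log d$ neighbors in $V_1$. Two sets $V_1,V_2$ have the same coloring if $|c^{ -1}(a)\cap V_1|=|c^{ -1}(a)\cap V_2|$ for every color $a$. $\log$ is the natural logarithm. -}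

module Defs where

open import Data.Nat using (ℕ; zero; suc; _+_; _*_; _∸_; _^_; _≤_; _<ᵇ_; _!)

open import Data.Bool using (Bool; true; false; _∧_; if_then_else_)
open import Data.Fin using (Fin; toℕ; _≟_)
open import Data.Fin.Subset using (Subset; ∣_∣; _∩_; Empty)
open import Data.Vec using (lookup)
open import Data.List using (map; allFin)
open import Data.Nat.ListAction using (sum)
open import Data.Product using (Σ; _×_)
open import Relation.Nullary.Decidable using (isYes)
open import Relation.Binary.PropositionalEquality using (_≡_)

-- expSum a N = Σ_{k=0}^{N} a^k · N!/k!   (so expSum a N / N! is the N-th
-- partial sum of the series of e^a).  Recursion:
--   expSum a 0 = 1,  expSum a (N+1) = (N+1)·expSum a N + a^(N+1).
expSum : ℕ → ℕ → ℕ
expSum a zero    = 1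
expSum a (suc N) = suc N * expSum a N + a ^ suc N

-- LogGE d a b  means   a / b ≤ log d   (for b > 0),
-- i.e. e^a ≤ d^b, i.e. every partial sum of e^a is ≤ d^b.
LogGE : ℕ → ℕ → ℕ → Set
LogGE d a b = (N : ℕ) → expSum a N ≤ d ^ b * N !

-- LogLE d a b  means   log d ≤ a / b   (for b > 0),
-- i.e. d^b ≤ e^a, i.e. some partial sum of e^a is ≥ d^b
-- (exact since e^a is irrational for a ≥ 1, and e^0 = 1 is a partial sum).
LogLE : ℕ → ℕ → ℕ → Set
LogLE d a b = Σ ℕ (λ N → d ^ b * N ! ≤ expSum a N)

record Graph (n : ℕ) : Set where
  field
    adj    : Fin n → Fin n → Bool
    sym    : ∀ u v → adj u v ≡ adj v u
    irrefl : ∀ v → adj v v ≡ false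
open Graph public

sumF : {n : ℕ} → (Fin n → ℕ) → ℕ
sumF {n} f = sum (map f (allFin n))

countF : {n : ℕ} → (Fin n → Bool) → ℕ
countF p = sumF (λ i → if p i then 1 else 0)

mem : {n : ℕ} → Subset n → Fin n → Bool
mem U v = lookup U v

degree : {n : ℕ} → Graph n → Fin n → ℕ
degree G v = countF (λ w → adj G v w)

Regular : {n : ℕ} → Graph n → ℕ → Set
Regular G d = ∀ v → degree G v ≡ d

eIn : {n : ℕ} → Graph n → Subset n → ℕ
eIn G U = sumF (λ u → countF (λ w → mem U u ∧ mem U w ∧ (toℕ u <ᵇ toℕ w) ∧ adj G u w))

-- e_G(T,U): number of edges between T and U (T, U disjoint)
eBetween : {n : ℕ} → Graph n → Subset n → Subset n → ℕ
eBetween G T U = sumF (λ u → countF (λ w → mem T u ∧ mem U w ∧ adj G u w))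

degIn : {n : ℕ} → Graph n → Subset n → Fin n → ℕ
degIn G V v = countF (λ w → mem V w ∧ adj G v w)

Disjoint : {n : ℕ} → Subset n → Subset n → Set
Disjoint T U = Empty (T ∩ U)

-- (P1): |U| ≤ (30 log d / d) n  ⇒  e_G(U) ≤ 100 |U| log d.
-- Written as: |U| d / (30 n) ≤ log d  ⇒  e_G(U) / (100 |U|) ≤ log d
-- (the case U = ∅ is trivial and excluded so that 100|U| > 0).
P1 : {n : ℕ} → Graph n → ℕ → Set
P1 {n} G d = (U : Subset n) → 1 ≤ ∣ U ∣ →
  LogGE d (∣ U ∣ * d) (30 * n) → LogGE d (eIn G U) (100 * ∣ U ∣)

-- (P2): |T| ≥ (10 log d/d) n, |U| ≥ (100 log d/d) n, T ∩ U = ∅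
--        ⇒ e_G(T,U) ≥ |T||U| d / (20 n).
P2 : {n : ℕ} → Graph n → ℕ → Set
P2 {n} G d = (T U : Subset n) → Disjoint T U →
  LogLE d (∣ T ∣ * d) (10 * n) → LogLE d (∣ U ∣ * d) (100 * n) →
  ∣ T ∣ * ∣ U ∣ * d ≤ 20 * n * eBetween G T U

α : ℕ
α = 100000

-- (α log d/(4d)) n ≤ |V|  ⇔  log d ≤ 4 d |V| / (α n)
-- |V| ≤ (α log d/(2d)) n  ⇔  2 d |V| / (α n) ≤ log d
-- deg_V(v) ≥ (α/160) log d = 625 log d  ⇔  log d ≤ deg_V(v) / 625
Dense : {n : ℕ} → Graph n → ℕ → Subset n → Set
Dense {n} G d V =
  LogLE d (4 * d * ∣ V ∣) (α * n) ×
  LogGE d (2 * d * ∣ V ∣) (α * n) ×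
  ((v : Fin n) → mem V v ≡ true → LogLE d (degIn G V v) 625)

colourCount : {n k : ℕ} → (Fin n → Fin k) → Subset n → Fin k → ℕ
colourCount c V a = countF (λ v → mem V v ∧ isYes (c v ≟ a))

SameColouring : {n k : ℕ} → (Fin n → Fin k) → Subset n → Subset n → Set
SameColouring c V₁ V₂ = ∀ a → colourCount c V₁ a ≡ colourCount c V₂ a

-- Greedy pairing gives disjoint X, Y with the same colouring and |X| = |Y| = p: while fewer than
-- 2p + k vertices are used, two unused vertices share a colour. Then a vertex with few neighbours in
-- its own set is deleted repeatedly, together with a vertex of the same colour from the other set.
-- The vertices dropped from X for this reason have few neighbours in every later X, so by (P2) fewer
-- than τ ≈ 10 n log d / d of them are ever dropped while X is large; hence each set loses fewer than
-- 2τ vertices and stays dense. Logarithms only enter through J with 2^J ≤ d ≤ 2^(J+1):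
-- e^a ≤ d^B once 12a + 28 ≤ 7JB (from a^a/a! ≤ ((16/15)^16)^a), and d^B ≤ e^A once (J+1)B < A
-- (from A^A/A! ≥ 2^(A-1)).

module Submission where

open import Defs hiding (sym)
open import Data.Bool using (Bool; true; false; _∧_; _∨_; not; if_then_else_)
import Data.Bool as Bool
open import Data.Bool.Properties using (∧-comm; ∧-conicalˡ; ∧-conicalʳ; ∧-identityʳ)
open import Data.Empty using (⊥; ⊥-elim)
open import Data.Fin using (Fin; zero; suc; punchIn; _≟_)
open import Data.Fin.Properties using (punchInᵢ≢i; any?)
open import Data.Fin.Subset using (Subset; ∣_∣)
import Data.List as List
open import Data.List.Properties using (map-tabulate)
open import Data.Nat hiding (_≟_)
open import Data.Nat.DivMod using (_/_; _%_; m≡m%n+[m/n]*n; m%n<n; m/n*n≤m)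
open import Data.Nat.ListAction using () renaming (sum to sumᴸ)
open import Data.Nat.Properties hiding (_≟_)
open import Data.Nat.Tactic.RingSolver using (solve-∀)
open import Data.Product using (Σ; ∃; ∃₂; _×_; _,_; proj₁; proj₂)
open import Data.Sum using (_⊎_; inj₁; inj₂)
open import Data.Vec using (tabulate; lookup; zipWith)
open import Data.Vec.Properties using (lookup∘tabulate; []=⇒lookup; lookup-zipWith)
open import Function using (_∘_; id)
open import Relation.Binary.PropositionalEquality
open import Relation.Nullary using (Dec; ¬_; yes; no)
open import Relation.Nullary.Decidable using (⌊_⌋; _×-dec_)
open import Algebra.Properties.CommutativeSemigroup *-commutativeSemigroup
  using (interchange; x∙yz≈y∙xz; x∙yz≈yx∙z; xy∙z≈xz∙y; x∙yz≈z∙xy)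
open import Algebra.Properties.Semiring.Sum +-*-semiring
  using (sum; sum-syntax; sum-cong-≗; sum-remove; ∑-comm; ∑-distrib-+; *-distribˡ-sum)

-- Exponential partial sums and comparisons of logarithms

^-distrib-* : ∀ m n o → (m * n) ^ o ≡ m ^ o * n ^ o
^-distrib-* m n zero    = refl
^-distrib-* m n (suc o) =
  trans (cong (m * n *_) (^-distrib-* m n o)) (interchange m n (m ^ o) (n ^ o))

^-cancelʳ-≤ : ∀ o {m n} → m ^ suc o ≤ n ^ suc o → m ≤ n
^-cancelʳ-≤ o m^o≤n^o = ≮⇒≥ (λ n<m → <⇒≱ (^-monoˡ-< (suc o) n<m) m^o≤n^o)

^-comm-^ : ∀ m a b → (m ^ a) ^ b ≡ (m ^ b) ^ a
^-comm-^ m a b = trans (^-*-assoc m a b) (trans (cong (m ^_) (*-comm a b)) (sym (^-*-assoc m b a)))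

-- (1 + 1/x)^m ≥ 1 + m/x, cleared of denominators.
bernoulli : ∀ x m → x ^ m * (x + m) ≤ x * (x + 1) ^ m
bernoulli x zero = ≤-reflexive (rearrange x)
  where rearrange : ∀ x → 1 * (x + 0) ≡ x * 1
        rearrange = solve-∀
bernoulli x (suc m) = begin
  x * x ^ m * (x + suc m)             ≤⟨ m≤m+n _ _ ⟩
  x * x ^ m * (x + suc m) + x ^ m * m ≡⟨ rearrange₁ x (x ^ m) m ⟩
  (x + 1) * (x ^ m * (x + m))         ≤⟨ *-monoʳ-≤ (x + 1) (bernoulli x m) ⟩
  (x + 1) * (x * (x + 1) ^ m)         ≡⟨ rearrange₂ x ((x + 1) ^ m) ⟩
  x * ((x + 1) * (x + 1) ^ m)         ∎
  where
    open ≤-Reasoning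
    rearrange₁ : ∀ x y m → x * y * (x + suc m) + y * m ≡ (x + 1) * (y * (x + m))
    rearrange₁ = solve-∀
    rearrange₂ : ∀ x z → (x + 1) * (x * z) ≡ x * ((x + 1) * z)
    rearrange₂ = solve-∀

-- (1 - 1/y)^j ≥ 1 - j/y for y = x + 1, cleared of denominators.
bernoulli⁻ : ∀ x j → (x + 1) ^ j * (x + 1) ≤ x ^ j * (x + 1) + j * (x + 1) ^ j
bernoulli⁻ x zero = ≤-reflexive (sym (+-identityʳ _))
bernoulli⁻ x (suc j) = begin
  (x + 1) * (x + 1) ^ j * (x + 1)
    ≡⟨ rearrange₁ x ((x + 1) ^ j) ⟩
  x * ((x + 1) ^ j * (x + 1)) + (x + 1) ^ j * (x + 1)
    ≤⟨ +-monoˡ-≤ _ (*-monoʳ-≤ x (bernoulli⁻ x j)) ⟩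
  x * (x ^ j * (x + 1) + j * (x + 1) ^ j) + (x + 1) ^ j * (x + 1)
    ≤⟨ m≤m+n _ (j * (x + 1) ^ j) ⟩
  x * (x ^ j * (x + 1) + j * (x + 1) ^ j) + (x + 1) ^ j * (x + 1) + j * (x + 1) ^ j
    ≡⟨ rearrange₂ x (x ^ j) ((x + 1) ^ j) j ⟩
  x * x ^ j * (x + 1) + suc j * ((x + 1) * (x + 1) ^ j) ∎
  where
    open ≤-Reasoning
    rearrange₁ : ∀ x z → (x + 1) * z * (x + 1) ≡ x * (z * (x + 1)) + z * (x + 1)
    rearrange₁ = solve-∀
    rearrange₂ : ∀ x w z j → x * (w * (x + 1) + j * z) + z * (x + 1) + j * z
                             ≡ x * w * (x + 1) + suc j * ((x + 1) * z)
    rearrange₂ = solve-∀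

2^n*n!≤2*n^n : ∀ m → 2 ^ suc m * suc m ! ≤ 2 * suc m ^ suc m
2^n*n!≤2*n^n zero    = ≤-refl
2^n*n!≤2*n^n (suc m) = begin
  2 * 2 ^ suc m * (suc (suc m) * suc m !)  ≡⟨ rearrange₁ (2 ^ suc m) (suc m !) m ⟩
  (suc (suc m) * 2) * (2 ^ suc m * suc m !) ≤⟨ *-monoʳ-≤ (suc (suc m) * 2) (2^n*n!≤2*n^n m) ⟩
  (suc (suc m) * 2) * (2 * suc m ^ suc m)   ≡⟨ rearrange₂ (suc m ^ suc m) m ⟩
  2 * (suc (suc m) * (2 * suc m ^ suc m))   ≤⟨ *-monoʳ-≤ 2 (*-monoʳ-≤ (suc (suc m)) 2[1+m]^[1+m]≤[2+m]^[1+m]) ⟩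
  2 * (suc (suc m) * suc (suc m) ^ suc m)   ∎
  where
    open ≤-Reasoning
    rearrange₁ : ∀ p f m → 2 * p * (suc (suc m) * f) ≡ (suc (suc m) * 2) * (p * f)
    rearrange₁ = solve-∀
    rearrange₂ : ∀ z m → (suc (suc m) * 2) * (2 * z) ≡ 2 * (suc (suc m) * (2 * z))
    rearrange₂ = solve-∀
    rearrange₃ : ∀ z m → suc m * (2 * z) ≡ z * (suc m + suc m)
    rearrange₃ = solve-∀
    2[1+m]^[1+m]≤[2+m]^[1+m] : 2 * suc m ^ suc m ≤ suc (suc m) ^ suc m
    2[1+m]^[1+m]≤[2+m]^[1+m] = *-cancelˡ-≤ (suc m) (begin
      suc m * (2 * suc m ^ suc m)     ≡⟨ rearrange₃ (suc m ^ suc m) m ⟩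
      suc m ^ suc m * (suc m + suc m) ≤⟨ bernoulli (suc m) (suc m) ⟩
      suc m * (suc m + 1) ^ suc m     ≡⟨ cong (λ z → suc m * z ^ suc m) (+-comm (suc m) 1) ⟩
      suc m * suc (suc m) ^ suc m     ∎)

^≤expSum : ∀ a N → a ^ N ≤ expSum a N
^≤expSum a zero    = ≤-refl
^≤expSum a (suc N) = m≤n+m (a ^ suc N) (suc N * expSum a N)

expSum-monoˡ-≤ : ∀ {a b} N → a ≤ b → expSum a N ≤ expSum b N
expSum-monoˡ-≤ zero    a≤b = ≤-refl
expSum-monoˡ-≤ (suc N) a≤b = +-mono-≤ (*-monoʳ-≤ (suc N) (expSum-monoˡ-≤ N a≤b)) (^-monoˡ-≤ (suc N) a≤b)

expSum-monoˡ-< : ∀ {a b} N → a < b → expSum a (suc N) < expSum b (suc N)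
expSum-monoˡ-< N a<b = +-mono-≤-< (*-monoʳ-≤ (suc N) (expSum-monoˡ-≤ N (<⇒≤ a<b))) (^-monoˡ-< (suc N) a<b)

LogGE∧LogLE⇒≤ : ∀ {d a a′ b} → 2 ≤ d → 1 ≤ b → LogGE d a b → LogLE d a′ b → a ≤ a′
LogGE∧LogLE⇒≤ {d} {a} {a′} {b} 2≤d 1≤b e^a≤d^b (N , d^b≤e^a′) = ≮⇒≥ (impossible N d^b≤e^a′ (e^a≤d^b N))
  where
    2≤d^b : 2 ≤ d ^ b
    2≤d^b = ≤-trans (^-monoʳ-≤ 2 1≤b) (^-monoˡ-≤ b 2≤d)
    impossible : ∀ N → d ^ b * N ! ≤ expSum a′ N → expSum a N ≤ d ^ b * N ! → a′ < a → ⊥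
    impossible zero    lower _     _   = <⇒≱ 2≤d^b (≤-trans (≤-reflexive (sym (*-identityʳ (d ^ b)))) lower)
    impossible (suc N) lower upper a′<a = <⇒≱ (expSum-monoˡ-< N a′<a) (≤-trans upper lower)

-- Since e^A ≥ A^A/A! ≥ 2^(A-1), the hypotheses give d^B ≤ 2^((1+j)B) ≤ 2^(A-1) ≤ e^A.
≤2^⇒LogLE : ∀ {d} j {A B} → d ≤ 2 ^ suc j → suc j * B < A → LogLE d A B
≤2^⇒LogLE {d} j {suc A} {B} d≤2^[1+j] [1+j]B≤A = suc A , (begin
  d ^ B * suc A !            ≤⟨ *-monoˡ-≤ (suc A !) (^-monoˡ-≤ B d≤2^[1+j]) ⟩
  (2 ^ suc j) ^ B * suc A !  ≡⟨ cong (_* suc A !) (^-*-assoc 2 (suc j) B) ⟩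
  2 ^ (suc j * B) * suc A !  ≤⟨ *-monoˡ-≤ (suc A !) (^-monoʳ-≤ 2 (≤-pred [1+j]B≤A)) ⟩
  2 ^ A * suc A !            ≤⟨ *-cancelˡ-≤ 2 (≤-trans (≤-reflexive (sym (*-assoc 2 (2 ^ A) (suc A !)))) (2^n*n!≤2*n^n A)) ⟩
  suc A ^ suc A              ≤⟨ ^≤expSum (suc A) (suc A) ⟩
  expSum (suc A) (suc A)     ∎)
  where open ≤-Reasoning

a^k*a!≤a^a*k! : ∀ a k → a ^ k * a ! ≤ a ^ a * k !
a^k*a!≤a^a*k! a k with ≤-total k a
... | inj₁ k≤a = below k (a ∸ k) (m+[n∸m]≡n k≤a)
  where
    below : ∀ k i → k + i ≡ a → a ^ k * a ! ≤ a ^ a * k !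
    below k zero    refl rewrite +-identityʳ k = ≤-refl
    below k (suc i) k+1+i≡a = *-cancelˡ-≤ a {{>-nonZero (≤-trans (s≤s z≤n) 1+k≤a)}} (begin
      a * (a ^ k * a !)      ≡⟨ sym (*-assoc a (a ^ k) (a !)) ⟩
      a ^ suc k * a !        ≤⟨ below (suc k) i (trans (sym (+-suc k i)) k+1+i≡a) ⟩
      a ^ a * (suc k * k !)  ≤⟨ *-monoʳ-≤ (a ^ a) (*-monoˡ-≤ (k !) 1+k≤a) ⟩
      a ^ a * (a * k !)      ≡⟨ x∙yz≈y∙xz (a ^ a) a (k !) ⟩
      a * (a ^ a * k !)      ∎)
      where
        open ≤-Reasoning
        1+k≤a : suc k ≤ a
        1+k≤a = subst (suc k ≤_) k+1+i≡a (≤-trans (s≤s (m≤m+n k i)) (≤-reflexive (sym (+-suc k i))))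
... | inj₂ a≤k = subst (λ k → a ^ k * a ! ≤ a ^ a * k !) (m+[n∸m]≡n a≤k) (above (k ∸ a))
  where
    above : ∀ i → a ^ (a + i) * a ! ≤ a ^ a * (a + i) !
    above zero rewrite +-identityʳ a = ≤-refl
    above (suc i) rewrite +-suc a i = begin
      a * a ^ (a + i) * a !              ≡⟨ *-assoc a _ _ ⟩
      a * (a ^ (a + i) * a !)            ≤⟨ *-monoʳ-≤ a (above i) ⟩
      a * (a ^ a * (a + i) !)            ≤⟨ *-monoˡ-≤ _ (≤-trans (m≤m+n a i) (n≤1+n _)) ⟩
      suc (a + i) * (a ^ a * (a + i) !)  ≡⟨ x∙yz≈y∙xz (suc (a + i)) (a ^ a) ((a + i) !) ⟩
      a ^ a * (suc (a + i) * (a + i) !)  ∎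
      where open ≤-Reasoning

expSum*a!≤[1+N]*N!*a^a : ∀ a N → expSum a N * a ! ≤ suc N * N ! * a ^ a
expSum*a!≤[1+N]*N!*a^a a zero = ≤-trans (a^k*a!≤a^a*k! a 0) (≤-reflexive (*-comm (a ^ a) 1))
expSum*a!≤[1+N]*N!*a^a a (suc N) = begin
  (suc N * expSum a N + a ^ suc N) * a !
    ≡⟨ *-distribʳ-+ (a !) (suc N * expSum a N) (a ^ suc N) ⟩
  suc N * expSum a N * a ! + a ^ suc N * a !
    ≡⟨ cong (_+ a ^ suc N * a !) (*-assoc (suc N) (expSum a N) (a !)) ⟩
  suc N * (expSum a N * a !) + a ^ suc N * a !
    ≤⟨ +-mono-≤ (*-monoʳ-≤ (suc N) (expSum*a!≤[1+N]*N!*a^a a N)) (a^k*a!≤a^a*k! a (suc N)) ⟩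
  suc N * (suc N * N ! * a ^ a) + a ^ a * (suc N * N !)
    ≡⟨ rearrange N (N !) (a ^ a) ⟩
  suc (suc N) * (suc N * N !) * a ^ a ∎
  where
    open ≤-Reasoning
    rearrange : ∀ N f z → suc N * (suc N * f * z) + z * (suc N * f) ≡ suc (suc N) * (suc N * f) * z
    rearrange = solve-∀

-- Beyond the 2a-th term consecutive terms at least halve, so the tail is at most twice its first term.
expSum-tail : ∀ a i → expSum a (i + 2 * a) * a ! + 2 * (a ^ (i + 2 * a) * a !)
                      ≤ (2 * a + 3) * (i + 2 * a) ! * a ^ a
expSum-tail a zero = begin
  expSum a (2 * a) * a ! + 2 * (a ^ (2 * a) * a !)
    ≤⟨ +-mono-≤ (expSum*a!≤[1+N]*N!*a^a a (2 * a)) (*-monoʳ-≤ 2 (a^k*a!≤a^a*k! a (2 * a))) ⟩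
  suc (2 * a) * (2 * a) ! * a ^ a + 2 * (a ^ a * (2 * a) !)
    ≡⟨ rearrange a ((2 * a) !) (a ^ a) ⟩
  (2 * a + 3) * (2 * a) ! * a ^ a ∎
  where
    open ≤-Reasoning
    rearrange : ∀ a f z → suc (2 * a) * f * z + 2 * (z * f) ≡ (2 * a + 3) * f * z
    rearrange = solve-∀
expSum-tail a (suc i) = begin
  (suc N * E + a * a ^ N) * a ! + 2 * (a * a ^ N * a !)
    ≡⟨ rearrange₁ (suc N) E a (a ^ N) (a !) ⟩
  suc N * (E * a !) + (3 * a) * (a ^ N * a !)
    ≤⟨ +-monoʳ-≤ (suc N * (E * a !)) (*-monoˡ-≤ (a ^ N * a !) 3a≤2[1+N]) ⟩
  suc N * (E * a !) + (2 * suc N) * (a ^ N * a !)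
    ≡⟨ rearrange₂ (suc N) (E * a !) (a ^ N * a !) ⟩
  suc N * (E * a ! + 2 * (a ^ N * a !))
    ≤⟨ *-monoʳ-≤ (suc N) (expSum-tail a i) ⟩
  suc N * ((2 * a + 3) * N ! * a ^ a)
    ≡⟨ rearrange₃ (suc N) (2 * a + 3) (N !) (a ^ a) ⟩
  (2 * a + 3) * (suc N * N !) * a ^ a ∎
  where
    open ≤-Reasoning
    N = i + 2 * a
    E = expSum a N
    rearrange₁ : ∀ s E a p f → (s * E + a * p) * f + 2 * (a * p * f) ≡ s * (E * f) + (3 * a) * (p * f)
    rearrange₁ = solve-∀
    rearrange₂ : ∀ s x y → s * x + (2 * s) * y ≡ s * (x + 2 * y)
    rearrange₂ = solve-∀
    rearrange₃ : ∀ s c f z → s * (c * f * z) ≡ c * (s * f) * z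
    rearrange₃ = solve-∀
    3a≤2[1+N] : 3 * a ≤ 2 * suc N
    3a≤2[1+N] = ≤-trans (*-monoˡ-≤ a (≤ᵇ⇒≤ 3 4 _)) (≤-trans (≤-reflexive (*-assoc 2 2 a))
                  (*-monoʳ-≤ 2 (≤-trans (m≤n+m (2 * a) i) (n≤1+n N))))

expSum*a!≤[2a+3]*N!*a^a : ∀ a N → expSum a N * a ! ≤ (2 * a + 3) * N ! * a ^ a
expSum*a!≤[2a+3]*N!*a^a a N with N ≤? 2 * a
... | yes N≤2a = ≤-trans (expSum*a!≤[1+N]*N!*a^a a N) (*-monoˡ-≤ (a ^ a) (*-monoˡ-≤ (N !) 1+N≤2a+3))
  where
    1+N≤2a+3 : suc N ≤ 2 * a + 3
    1+N≤2a+3 = ≤-trans (s≤s N≤2a) (≤-trans (m≤m+n (suc (2 * a)) 2) (≤-reflexive (sym (+-suc (2 * a) 2))))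
... | no N≰2a = subst (λ N → expSum a N * a ! ≤ (2 * a + 3) * N ! * a ^ a) (m∸n+n≡m 2a≤N)
                  (≤-trans (m≤m+n _ _) (expSum-tail a (N ∸ 2 * a)))
  where 2a≤N = <⇒≤ (≰⇒> N≰2a)

-- With M = 1+m, K = 1+k and Y = MK, Bernoulli's inequalities give ((K+1)/K)^K ≤ (Y/(Y-1))^(MK) ≤ (M/m)^M.
[1+1/k]^k≤[1+1/m]^[1+m] : ∀ m k → m ^ suc m * suc k ^ k ≤ suc m ^ suc m * k ^ k
[1+1/k]^k≤[1+1/m]^[1+m] m zero    = *-monoˡ-≤ 1 (^-monoˡ-≤ (suc m) (n≤1+n m))
[1+1/k]^k≤[1+1/m]^[1+m] m (suc k) = *-cancelˡ-≤ (Y ^ (M * K)) {{m^n≢0 Y (M * K)}} (begin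
  Y ^ (M * K) * (m ^ M * suc K ^ K)     ≡⟨ x∙yz≈yx∙z (Y ^ (M * K)) (m ^ M) (suc K ^ K) ⟩
  m ^ M * Y ^ (M * K) * suc K ^ K       ≤⟨ *-monoˡ-≤ (suc K ^ K) [Y/y]^MK≤[M/m]^M ⟩
  M ^ M * y ^ (M * K) * suc K ^ K       ≡⟨ *-assoc (M ^ M) (y ^ (M * K)) (suc K ^ K) ⟩
  M ^ M * (y ^ (M * K) * suc K ^ K)     ≤⟨ *-monoʳ-≤ (M ^ M) [1+1/K]^K≤[Y/y]^MK ⟩
  M ^ M * (Y ^ (M * K) * K ^ K)         ≡⟨ x∙yz≈y∙xz (M ^ M) (Y ^ (M * K)) (K ^ K) ⟩
  Y ^ (M * K) * (M ^ M * K ^ K)         ∎)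
  where
    open ≤-Reasoning
    M = suc m
    K = suc k
    y = k + m * suc k
    Y = suc y

    [Y/y]^M≥1+1/K : y ^ M * suc K ≤ Y ^ M * K
    [Y/y]^M≥1+1/K = *-cancelˡ-≤ M (begin
      M * (y ^ M * suc K)       ≡⟨ rearrange₁ m k (y ^ M) ⟩
      y ^ M * (Y + M)           ≤⟨ *-cancelˡ-≤ (Y ^ M) {{m^n≢0 Y M}} (begin
        Y ^ M * (y ^ M * (Y + M))  ≡⟨ x∙yz≈y∙xz (Y ^ M) (y ^ M) (Y + M) ⟩
        y ^ M * (Y ^ M * (Y + M))  ≤⟨ *-monoʳ-≤ (y ^ M) (bernoulli Y M) ⟩
        y ^ M * (Y * (Y + 1) ^ M)  ≡⟨ x∙yz≈y∙xz (y ^ M) Y ((Y + 1) ^ M) ⟩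
        Y * (y ^ M * (Y + 1) ^ M)  ≡⟨ cong (Y *_) (sym (^-distrib-* y (Y + 1) M)) ⟩
        Y * (y * (Y + 1)) ^ M      ≤⟨ *-monoʳ-≤ Y (^-monoˡ-≤ M y[Y+1]≤Y*Y) ⟩
        Y * (Y * Y) ^ M            ≡⟨ cong (Y *_) (^-distrib-* Y Y M) ⟩
        Y * (Y ^ M * Y ^ M)        ≡⟨ x∙yz≈y∙xz Y (Y ^ M) (Y ^ M) ⟩
        Y ^ M * (Y * Y ^ M)        ∎) ⟩
      Y * Y ^ M                 ≡⟨ rearrange₂ m k (Y ^ M) ⟩
      M * (Y ^ M * K)           ∎)
      where
        y[Y+1]≤Y*Y : y * (Y + 1) ≤ Y * Y
        y[Y+1]≤Y*Y = ≤-trans (m≤m+n _ 1) (≤-reflexive (rearrange₀ y))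
          where rearrange₀ : ∀ y → y * (suc y + 1) + 1 ≡ suc y * suc y
                rearrange₀ = solve-∀
        rearrange₁ : ∀ m k p → suc m * (p * suc (suc k)) ≡ p * (suc (k + m * suc k) + suc m)
        rearrange₁ = solve-∀
        rearrange₂ : ∀ m k q → suc (k + m * suc k) * q ≡ suc m * (q * suc k)
        rearrange₂ = solve-∀

    [Y/y]^K≤M/m : m * Y ^ K ≤ M * y ^ K
    [Y/y]^K≤M/m = +-cancelʳ-≤ (Y ^ K) (m * Y ^ K) (M * y ^ K) (*-cancelˡ-≤ K (begin
      K * (m * Y ^ K + Y ^ K)   ≡⟨ rearrange₁ m k (Y ^ K) ⟩
      Y ^ K * Y                 ≤⟨ subst (λ z → z ^ K * z ≤ y ^ K * z + K * z ^ K) (+-comm y 1) (bernoulli⁻ y K) ⟩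
      y ^ K * Y + K * Y ^ K     ≡⟨ rearrange₂ m k (y ^ K) (Y ^ K) ⟩
      K * (M * y ^ K + Y ^ K)   ∎))
      where
        rearrange₁ : ∀ m k q → suc k * (m * q + q) ≡ q * suc (k + m * suc k)
        rearrange₁ = solve-∀
        rearrange₂ : ∀ m k p q → p * suc (k + m * suc k) + suc k * q ≡ suc k * (suc m * p + q)
        rearrange₂ = solve-∀

    [1+1/K]^K≤[Y/y]^MK : y ^ (M * K) * suc K ^ K ≤ Y ^ (M * K) * K ^ K
    [1+1/K]^K≤[Y/y]^MK = begin
      y ^ (M * K) * suc K ^ K  ≡⟨ cong (_* suc K ^ K) (sym (^-*-assoc y M K)) ⟩
      (y ^ M) ^ K * suc K ^ K  ≡⟨ sym (^-distrib-* (y ^ M) (suc K) K) ⟩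
      (y ^ M * suc K) ^ K      ≤⟨ ^-monoˡ-≤ K [Y/y]^M≥1+1/K ⟩
      (Y ^ M * K) ^ K          ≡⟨ ^-distrib-* (Y ^ M) K K ⟩
      (Y ^ M) ^ K * K ^ K      ≡⟨ cong (_* K ^ K) (^-*-assoc Y M K) ⟩
      Y ^ (M * K) * K ^ K      ∎

    [Y/y]^MK≤[M/m]^M : m ^ M * Y ^ (M * K) ≤ M ^ M * y ^ (M * K)
    [Y/y]^MK≤[M/m]^M = begin
      m ^ M * Y ^ (M * K)    ≡⟨ cong (m ^ M *_) (^-comm-^′ Y) ⟩
      m ^ M * (Y ^ K) ^ M    ≡⟨ sym (^-distrib-* m (Y ^ K) M) ⟩
      (m * Y ^ K) ^ M        ≤⟨ ^-monoˡ-≤ M [Y/y]^K≤M/m ⟩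
      (M * y ^ K) ^ M        ≡⟨ ^-distrib-* M (y ^ K) M ⟩
      M ^ M * (y ^ K) ^ M    ≡⟨ cong (M ^ M *_) (sym (^-comm-^′ y)) ⟩
      M ^ M * y ^ (M * K)    ∎
      where
        ^-comm-^′ : ∀ z → z ^ (M * K) ≡ (z ^ K) ^ M
        ^-comm-^′ z = trans (sym (^-*-assoc z M K)) (^-comm-^ z M K)

a^a≤[1+1/m]^[[1+m]a]*a! : ∀ m a → (m ^ suc m) ^ a * a ^ a ≤ (suc m ^ suc m) ^ a * a !
a^a≤[1+1/m]^[[1+m]a]*a! m zero    = ≤-refl
a^a≤[1+1/m]^[[1+m]a]*a! m (suc a) = begin
  c₁ * c₁ ^ a * (suc a * suc a ^ a)    ≡⟨ rearrange₁ c₁ (c₁ ^ a) (suc a) (suc a ^ a) ⟩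
  suc a * (c₁ * suc a ^ a) * c₁ ^ a    ≤⟨ *-monoˡ-≤ (c₁ ^ a) (*-monoʳ-≤ (suc a) ([1+1/k]^k≤[1+1/m]^[1+m] m a)) ⟩
  suc a * (c₂ * a ^ a) * c₁ ^ a        ≡⟨ rearrange₂ (suc a) c₂ (a ^ a) (c₁ ^ a) ⟩
  suc a * c₂ * (c₁ ^ a * a ^ a)        ≤⟨ *-monoʳ-≤ (suc a * c₂) (a^a≤[1+1/m]^[[1+m]a]*a! m a) ⟩
  suc a * c₂ * (c₂ ^ a * a !)          ≡⟨ rearrange₃ (suc a) c₂ (c₂ ^ a) (a !) ⟩
  c₂ * c₂ ^ a * (suc a * a !)          ∎
  where
    open ≤-Reasoning
    c₁ = m ^ suc m
    c₂ = suc m ^ suc m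
    rearrange₁ : ∀ c p s t → c * p * (s * t) ≡ s * (c * t) * p
    rearrange₁ = solve-∀
    rearrange₂ : ∀ s c t p → s * (c * t) * p ≡ s * c * (p * t)
    rearrange₂ = solve-∀
    rearrange₃ : ∀ s c q f → s * c * (q * f) ≡ c * q * (s * f)
    rearrange₃ = solve-∀

[a+8]*8^a≤8*9^a : ∀ a → (a + 8) * 8 ^ a ≤ 8 * 9 ^ a
[a+8]*8^a≤8*9^a zero    = ≤-refl
[a+8]*8^a≤8*9^a (suc a) = begin
  (suc a + 8) * (8 * 8 ^ a)   ≤⟨ ≤-trans (≤-reflexive (rearrange₁ a (8 ^ a))) (m≤m+n _ (a * 8 ^ a)) ⟩
  8 * (a + 9) * 8 ^ a + a * 8 ^ a ≡⟨ rearrange₂ a (8 ^ a) ⟩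
  9 * ((a + 8) * 8 ^ a)       ≤⟨ *-monoʳ-≤ 9 ([a+8]*8^a≤8*9^a a) ⟩
  9 * (8 * 9 ^ a)             ≡⟨ x∙yz≈y∙xz 9 8 (9 ^ a) ⟩
  8 * (9 * 9 ^ a)             ∎
  where
    open ≤-Reasoning
    rearrange₁ : ∀ a p → (suc a + 8) * (8 * p) ≡ 8 * (a + 9) * p
    rearrange₁ = solve-∀
    rearrange₂ : ∀ a p → 8 * (a + 9) * p + a * p ≡ 9 * ((a + 8) * p)
    rearrange₂ = solve-∀

-- e^a ≤ (2a+3) a^a/a! ≤ 16 (9/8)^a ((16/15)^16)^a.
expSum*[15^16*8]^a≤16*[16^16*9]^a*N! : ∀ a N → expSum a N * (15 ^ 16 * 8) ^ a ≤ 16 * (16 ^ 16 * 9) ^ a * N !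
expSum*[15^16*8]^a≤16*[16^16*9]^a*N! a N = *-cancelʳ-≤ _ _ (a !) {{a !≢0}} (begin
  E * (15 ^ 16 * 8) ^ a * a !                      ≡⟨ cong (λ z → E * z * a !) (^-distrib-* (15 ^ 16) 8 a) ⟩
  E * (c₁ ^ a * 8 ^ a) * a !                       ≡⟨ rearrange₁ E (c₁ ^ a) (8 ^ a) (a !) ⟩
  E * a ! * (c₁ ^ a * 8 ^ a)                       ≤⟨ *-monoˡ-≤ _ (expSum*a!≤[2a+3]*N!*a^a a N) ⟩
  (2 * a + 3) * N ! * a ^ a * (c₁ ^ a * 8 ^ a)     ≡⟨ rearrange₂ (2 * a + 3) (N !) (a ^ a) (c₁ ^ a) (8 ^ a) ⟩
  (2 * a + 3) * 8 ^ a * N ! * (c₁ ^ a * a ^ a)     ≤⟨ *-mono-≤ (*-monoˡ-≤ (N !) [2a+3]*8^a≤16*9^a) (a^a≤[1+1/m]^[[1+m]a]*a! 15 a) ⟩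
  16 * 9 ^ a * N ! * (c₂ ^ a * a !)                ≡⟨ rearrange₃ (9 ^ a) (N !) (c₂ ^ a) (a !) ⟩
  16 * (c₂ ^ a * 9 ^ a) * N ! * a !                ≡⟨ cong (λ z → 16 * z * N ! * a !) (sym (^-distrib-* c₂ 9 a)) ⟩
  16 * (16 ^ 16 * 9) ^ a * N ! * a !               ∎)
  where
    open ≤-Reasoning
    E = expSum a N
    c₁ = 15 ^ 16
    c₂ = 16 ^ 16
    [2a+3]*8^a≤16*9^a : (2 * a + 3) * 8 ^ a ≤ 16 * 9 ^ a
    [2a+3]*8^a≤16*9^a = begin
      (2 * a + 3) * 8 ^ a    ≤⟨ *-monoˡ-≤ (8 ^ a) (+-monoʳ-≤ (2 * a) (≤ᵇ⇒≤ 3 16 _)) ⟩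
      (2 * a + 16) * 8 ^ a   ≡⟨ cong (_* 8 ^ a) (sym (*-distribˡ-+ 2 a 8)) ⟩
      2 * (a + 8) * 8 ^ a    ≡⟨ *-assoc 2 (a + 8) (8 ^ a) ⟩
      2 * ((a + 8) * 8 ^ a)  ≤⟨ *-monoʳ-≤ 2 ([a+8]*8^a≤8*9^a a) ⟩
      2 * (8 * 9 ^ a)        ≡⟨ sym (*-assoc 2 8 (9 ^ a)) ⟩
      16 * 9 ^ a             ∎
    rearrange₁ : ∀ E c e f → E * (c * e) * f ≡ E * f * (c * e)
    rearrange₁ = solve-∀
    rearrange₂ : ∀ t f p c e → t * f * p * (c * e) ≡ t * e * f * (c * p)
    rearrange₂ = solve-∀
    rearrange₃ : ∀ n f c g → 16 * n * f * (c * g) ≡ 16 * (c * n) * f * g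
    rearrange₃ = solve-∀

-- Taking (1+r)-th roots turns the bound e^a ≤ K (P/Q)^a into e^a ≤ 2^((x + y a)/(1+r)) ≤ d^B.
expSum≤K[P/Q]^a⇒LogGE : ∀ {K P Q} r {x y} .{{_ : NonZero Q}} →
  (∀ a N → expSum a N * Q ^ a ≤ K * P ^ a * N !) →
  K ^ suc r ≤ 2 ^ x → P ^ suc r ≤ 2 ^ y * Q ^ suc r →
  ∀ {d} j {a B} → 2 ^ j ≤ d → y * a + x ≤ suc r * (j * B) → LogGE d a B
expSum≤K[P/Q]^a⇒LogGE {K} {P} {Q} r {x} {y} e^a≤K[P/Q]^a K^r≤2^x P^r≤2^yQ^r {d} j {a} {B} 2^j≤d ya+x≤rjB N =
  *-cancelʳ-≤ _ _ (Q ^ a) {{m^n≢0 Q a}} (begin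
    expSum a N * Q ^ a   ≤⟨ e^a≤K[P/Q]^a a N ⟩
    K * P ^ a * N !      ≤⟨ *-monoˡ-≤ (N !) (^-cancelʳ-≤ r {K * P ^ a} {d ^ B * Q ^ a} [KP^a]^r≤[d^BQ^a]^r) ⟩
    d ^ B * Q ^ a * N !  ≡⟨ xy∙z≈xz∙y (d ^ B) (Q ^ a) (N !) ⟩
    d ^ B * N ! * Q ^ a  ∎)
  where
    open ≤-Reasoning
    R = suc r
    [KP^a]^r≤[d^BQ^a]^r : (K * P ^ a) ^ R ≤ (d ^ B * Q ^ a) ^ R
    [KP^a]^r≤[d^BQ^a]^r = begin
      (K * P ^ a) ^ R                      ≡⟨ trans (^-distrib-* K (P ^ a) R) (cong (K ^ R *_) (^-comm-^ P a R)) ⟩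
      K ^ R * (P ^ R) ^ a                  ≤⟨ *-mono-≤ K^r≤2^x (^-monoˡ-≤ a P^r≤2^yQ^r) ⟩
      2 ^ x * (2 ^ y * Q ^ R) ^ a          ≡⟨ cong (2 ^ x *_) (^-distrib-* (2 ^ y) (Q ^ R) a) ⟩
      2 ^ x * ((2 ^ y) ^ a * (Q ^ R) ^ a)  ≡⟨ sym (*-assoc (2 ^ x) _ _) ⟩
      2 ^ x * (2 ^ y) ^ a * (Q ^ R) ^ a    ≡⟨ cong (_* (Q ^ R) ^ a) 2^x[2^y]^a≡2^[ya+x] ⟩
      2 ^ (y * a + x) * (Q ^ R) ^ a        ≤⟨ *-monoˡ-≤ _ (^-monoʳ-≤ 2 ya+x≤rjB) ⟩
      2 ^ (R * (j * B)) * (Q ^ R) ^ a      ≡⟨ cong₂ _*_ 2^[RjB]≡[[2^j]^B]^R (^-comm-^ Q R a) ⟩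
      ((2 ^ j) ^ B) ^ R * (Q ^ a) ^ R      ≤⟨ *-monoˡ-≤ _ (^-monoˡ-≤ R (^-monoˡ-≤ B 2^j≤d)) ⟩
      (d ^ B) ^ R * (Q ^ a) ^ R            ≡⟨ sym (^-distrib-* (d ^ B) (Q ^ a) R) ⟩
      (d ^ B * Q ^ a) ^ R                  ∎
      where
        2^x[2^y]^a≡2^[ya+x] : 2 ^ x * (2 ^ y) ^ a ≡ 2 ^ (y * a + x)
        2^x[2^y]^a≡2^[ya+x] = trans (cong (2 ^ x *_) (^-*-assoc 2 y a))
                                (trans (sym (^-distribˡ-+-* 2 x (y * a))) (cong (2 ^_) (+-comm x (y * a))))
        2^[RjB]≡[[2^j]^B]^R : 2 ^ (R * (j * B)) ≡ ((2 ^ j) ^ B) ^ R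
        2^[RjB]≡[[2^j]^B]^R = sym (trans (cong (_^ R) (^-*-assoc 2 j B))
                                (trans (^-*-assoc 2 (j * B) R) (cong (2 ^_) (*-comm (j * B) R))))

-- 16^7 = 2^28 and ((16/15)^16 · 9/8)^7 ≤ 2^12.
2^≤⇒LogGE : ∀ {d} j {a B} → 2 ^ j ≤ d → 12 * a + 28 ≤ 7 * (j * B) → LogGE d a B
2^≤⇒LogGE = expSum≤K[P/Q]^a⇒LogGE {16} {16 ^ 16 * 9} {15 ^ 16 * 8} 6 {28} {12}
  expSum*[15^16*8]^a≤16*[16^16*9]^a*N! (≤ᵇ⇒≤ _ _ _) (≤ᵇ⇒≤ _ _ _)

-- Finite sets as Boolean predicates and their sizes

variable
  n k : ℕ

-- Sets are handled as predicates; tabulate turns them into Data.Fin.Subset vectors only at the end.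
Subsetᵇ : ℕ → Set
Subsetᵇ n = Fin n → Bool

_⊆ᵇ_ : Subsetᵇ n → Subsetᵇ n → Set
P ⊆ᵇ Q = ∀ {v} → P v ≡ true → Q v ≡ true

_∩ᵇ_ : Subsetᵇ n → Subsetᵇ n → Subsetᵇ n
(P ∩ᵇ Q) v = P v ∧ Q v

_∪ᵇ_ : Subsetᵇ n → Subsetᵇ n → Subsetᵇ n
(P ∪ᵇ Q) v = P v ∨ Q v

Disjointᵇ : Subsetᵇ n → Subsetᵇ n → Set
Disjointᵇ P Q = ∀ v → P v ∧ Q v ≡ false

Disjoint-⊆ : ∀ {P P′ Q Q′ : Subsetᵇ n} → P′ ⊆ᵇ P → Q′ ⊆ᵇ Q → Disjointᵇ P Q → Disjointᵇ P′ Q′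
Disjoint-⊆ {P = P} {P′} {Q} {Q′} P′⊆P Q′⊆Q disjoint v with P′ v in P′v | Q′ v in Q′v
... | false | _     = refl
... | true  | false = refl
... | true  | true  = trans (sym (cong₂ _∧_ (P′⊆P P′v) (Q′⊆Q Q′v))) (disjoint v)

⌊x≟x⌋≡true : ∀ (x : Fin n) → ⌊ x ≟ x ⌋ ≡ true
⌊x≟x⌋≡true x with x ≟ x
... | yes _   = refl
... | no x≢x = ⊥-elim (x≢x refl)

⌊x≟y⌋≡true⇒x≡y : ∀ {x y : Fin n} → ⌊ x ≟ y ⌋ ≡ true → x ≡ y
⌊x≟y⌋≡true⇒x≡y {x = x} {y} _ with x ≟ y
... | yes x≡y = x≡y

x≢y⇒⌊x≟y⌋≡false : ∀ {x y : Fin n} → x ≢ y → ⌊ x ≟ y ⌋ ≡ false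
x≢y⇒⌊x≟y⌋≡false {x = x} {y} x≢y with x ≟ y
... | yes x≡y = ⊥-elim (x≢y x≡y)
... | no _    = refl

⌊x≟y⌋≡false⇒x≢y : ∀ {x y : Fin n} → ⌊ x ≟ y ⌋ ≡ false → x ≢ y
⌊x≟y⌋≡false⇒x≢y {x = x} {y} _ with x ≟ y
... | no x≢y = x≢y

insert remove : Fin n → Subsetᵇ n → Subsetᵇ n
insert x P v = if ⌊ v ≟ x ⌋ then true else P v
remove x P v = if ⌊ v ≟ x ⌋ then false else P v

insert-self : ∀ x (P : Subsetᵇ n) → insert x P x ≡ true
insert-self x P rewrite ⌊x≟x⌋≡true x = refl

remove-self : ∀ x (P : Subsetᵇ n) → remove x P x ≡ false
remove-self x P rewrite ⌊x≟x⌋≡true x = refl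

insert⁻ : ∀ {x v} (P : Subsetᵇ n) → insert x P v ≡ true → v ≡ x ⊎ P v ≡ true
insert⁻ {x = x} {v} P v∈ with ⌊ v ≟ x ⌋ in v≟x
... | true  = inj₁ (⌊x≟y⌋≡true⇒x≡y v≟x)
... | false = inj₂ v∈

remove-⊆ : ∀ x (P : Subsetᵇ n) → remove x P ⊆ᵇ P
remove-⊆ x P {v} v∈ with ⌊ v ≟ x ⌋
... | false = v∈

remove-≢ : ∀ x (P : Subsetᵇ n) {v} → remove x P v ≡ true → v ≢ x
remove-≢ x P {v} v∈ with ⌊ v ≟ x ⌋ in v≢x
... | false = ⌊x≟y⌋≡false⇒x≢y v≢x

remove-cong : ∀ x {P Q : Subsetᵇ n} → (∀ v → ⌊ v ≟ x ⌋ ≡ false → P v ≡ Q v) →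
              ∀ v → remove x P v ≡ remove x Q v
remove-cong x P≗Q v with ⌊ v ≟ x ⌋ in v≢x
... | true  = refl
... | false = P≗Q v v≢x

insert-disjoint : ∀ {x y} {P Q : Subsetᵇ n} → Disjointᵇ P Q → x ≢ y → P y ≡ false → Q x ≡ false →
                  Disjointᵇ (insert x P) (insert y Q)
insert-disjoint {x = x} {y} {P} disjoint x≢y Py Qx v with ⌊ v ≟ x ⌋ in v≟x | ⌊ v ≟ y ⌋ in v≟y
... | true  | true  = ⊥-elim (x≢y (trans (sym (⌊x≟y⌋≡true⇒x≡y v≟x)) (⌊x≟y⌋≡true⇒x≡y v≟y)))
... | true  | false rewrite ⌊x≟y⌋≡true⇒x≡y v≟x = Qx
... | false | true  rewrite ⌊x≟y⌋≡true⇒x≡y v≟y = trans (∧-identityʳ (P y)) Py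
... | false | false = disjoint v

insert-remove-disjoint : ∀ x {P Q : Subsetᵇ n} → Disjointᵇ P Q → Disjointᵇ (insert x P) (remove x Q)
insert-remove-disjoint x disjoint v with ⌊ v ≟ x ⌋
... | true  = refl
... | false = disjoint v

𝟙 : Bool → ℕ
𝟙 b = if b then 1 else 0

count : Subsetᵇ n → ℕ
count {n} P = ∑[ v < n ] 𝟙 (P v)

sumF≡sum : ∀ (f : Fin n → ℕ) → sumF f ≡ sum f
sumF≡sum f = trans (cong sumᴸ (map-tabulate id f)) (sum-tabulate f)
  where
    sum-tabulate : ∀ {n} (f : Fin n → ℕ) → sumᴸ (List.tabulate f) ≡ sum f
    sum-tabulate {zero}  f = refl
    sum-tabulate {suc n} f = cong (f zero +_) (sum-tabulate (f ∘ suc))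

countF≡count : ∀ (P : Subsetᵇ n) → countF P ≡ count P
countF≡count P = sumF≡sum (𝟙 ∘ P)

sum-const : ∀ n c → ∑[ v < n ] c ≡ n * c
sum-const zero    c = refl
sum-const (suc n) c = cong (c +_) (sum-const n c)

sum-mono-≤ : ∀ {f g : Fin n → ℕ} → (∀ v → f v ≤ g v) → sum f ≤ sum g
sum-mono-≤ {zero}  f≤g = z≤n
sum-mono-≤ {suc n} f≤g = +-mono-≤ (f≤g zero) (sum-mono-≤ (f≤g ∘ suc))

count-cong : ∀ {P Q : Subsetᵇ n} → (∀ v → P v ≡ Q v) → count P ≡ count Q
count-cong P≗Q = sum-cong-≗ (cong 𝟙 ∘ P≗Q)

count-mono : ∀ {P Q : Subsetᵇ n} → P ⊆ᵇ Q → count P ≤ count Q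
count-mono {P = P} {Q} P⊆Q = sum-mono-≤ (λ v → 𝟙-mono (P v) (Q v) P⊆Q)
  where
    𝟙-mono : ∀ a b → (a ≡ true → b ≡ true) → 𝟙 a ≤ 𝟙 b
    𝟙-mono false b _   = z≤n
    𝟙-mono true  b a⇒b rewrite a⇒b refl = ≤-refl

count-∅ : count {n} (λ _ → false) ≡ 0
count-∅ {n} = trans (sum-const n 0) (*-zeroʳ n)

count-full : count {n} (λ _ → true) ≡ n
count-full {n} = trans (sum-const n 1) (*-identityʳ n)

count-+ : ∀ {P Q R : Subsetᵇ n} → (∀ v → 𝟙 (P v) + 𝟙 (Q v) ≡ 𝟙 (R v)) → count P + count Q ≡ count R
count-+ {P = P} {Q} PQ≗R = trans (sym (∑-distrib-+ (𝟙 ∘ P) (𝟙 ∘ Q))) (sum-cong-≗ PQ≗R)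

count-∪ : ∀ {P Q : Subsetᵇ n} → Disjointᵇ P Q → count P + count Q ≡ count (P ∪ᵇ Q)
count-∪ {P = P} {Q} disjoint = count-+ (λ v → 𝟙-∨ (P v) (Q v) (disjoint v))
  where
    𝟙-∨ : ∀ a b → a ∧ b ≡ false → 𝟙 a + 𝟙 b ≡ 𝟙 (a ∨ b)
    𝟙-∨ true  false _ = refl
    𝟙-∨ false b     _ = refl

count-complement : ∀ (P : Subsetᵇ n) → count P + count (not ∘ P) ≡ n
count-complement P = trans (count-+ (λ v → 𝟙-not (P v))) count-full
  where
    𝟙-not : ∀ a → 𝟙 a + 𝟙 (not a) ≡ 1
    𝟙-not true  = refl
    𝟙-not false = refl

count>0⇒nonempty : ∀ (P : Subsetᵇ n) → 0 < count P → ∃ λ v → P v ≡ true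
count>0⇒nonempty {suc n} P 0<count with P zero in P0
... | true  = zero , P0
... | false = let v , Pv = count>0⇒nonempty (P ∘ suc) 0<count in suc v , Pv

count-remove : ∀ x (P : Subsetᵇ n) → count P ≡ 𝟙 (P x) + count (remove x P)
count-remove {suc n} x P = begin
  count P                                            ≡⟨ sum-remove (𝟙 ∘ P) ⟩
  𝟙 (P x) + ∑[ j < n ] 𝟙 (P (punchIn x j))           ≡⟨ cong (𝟙 (P x) +_) (sum-cong-≗ (cong 𝟙 ∘ agree-off-x)) ⟩
  𝟙 (P x) + ∑[ j < n ] 𝟙 (remove x P (punchIn x j))
    ≡⟨ cong (λ b → 𝟙 (P x) + (𝟙 b + ∑[ j < n ] 𝟙 (remove x P (punchIn x j)))) (sym (remove-self x P)) ⟩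
  𝟙 (P x) + (𝟙 (remove x P x) + ∑[ j < n ] 𝟙 (remove x P (punchIn x j)))
                                                     ≡⟨ cong (𝟙 (P x) +_) (sym (sum-remove (𝟙 ∘ remove x P))) ⟩
  𝟙 (P x) + count (remove x P)                       ∎
  where
    open ≡-Reasoning
    agree-off-x : ∀ j → P (punchIn x j) ≡ remove x P (punchIn x j)
    agree-off-x j rewrite x≢y⇒⌊x≟y⌋≡false (punchInᵢ≢i x j) = refl

count-remove-∈ : ∀ {x} (P : Subsetᵇ n) → P x ≡ true → count P ≡ suc (count (remove x P))
count-remove-∈ {x = x} P Px = trans (count-remove x P) (cong (λ b → 𝟙 b + count (remove x P)) Px)

∈⇒count>0 : ∀ {x} (P : Subsetᵇ n) → P x ≡ true → 0 < count P
∈⇒count>0 P Px = ≤-trans (s≤s z≤n) (≤-reflexive (sym (count-remove-∈ P Px)))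

count-insert-∉ : ∀ {x} (P : Subsetᵇ n) → P x ≡ false → count (insert x P) ≡ suc (count P)
count-insert-∉ {x = x} P Px = begin
  count (insert x P)                     ≡⟨ count-remove x (insert x P) ⟩
  𝟙 (insert x P x) + count (remove x (insert x P))
                                         ≡⟨ cong₂ (λ b m → 𝟙 b + m) (insert-self x P) (count-cong (remove-cong x insert-off-x)) ⟩
  suc (count (remove x P))               ≡⟨ cong (λ b → suc (𝟙 b + count (remove x P))) (sym Px) ⟩
  suc (𝟙 (P x) + count (remove x P))     ≡⟨ cong suc (sym (count-remove x P)) ⟩
  suc (count P)                          ∎
  where
    open ≡-Reasoning
    insert-off-x : ∀ v → ⌊ v ≟ x ⌋ ≡ false → insert x P v ≡ P v
    insert-off-x v v≢x rewrite v≢x = refl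

count-∩-remove : ∀ {x} (P Q : Subsetᵇ n) → P x ≡ true → count (P ∩ᵇ Q) ≡ 𝟙 (Q x) + count (remove x P ∩ᵇ Q)
count-∩-remove {x = x} P Q Px = begin
  count (P ∩ᵇ Q)                             ≡⟨ count-remove x (P ∩ᵇ Q) ⟩
  𝟙 (P x ∧ Q x) + count (remove x (P ∩ᵇ Q))  ≡⟨ cong₂ (λ b m → 𝟙 (b ∧ Q x) + m) Px (count-cong remove-∩) ⟩
  𝟙 (Q x) + count (remove x P ∩ᵇ Q)          ∎
  where
    open ≡-Reasoning
    remove-∩ : ∀ v → remove x (P ∩ᵇ Q) v ≡ (remove x P ∩ᵇ Q) v
    remove-∩ v with ⌊ v ≟ x ⌋
    ... | true  = refl
    ... | false = refl

count-∩-insert : ∀ {x} (P Q : Subsetᵇ n) → P x ≡ false → count (insert x P ∩ᵇ Q) ≡ 𝟙 (Q x) + count (P ∩ᵇ Q)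
count-∩-insert {x = x} P Q Px = begin
  count (insert x P ∩ᵇ Q)                               ≡⟨ count-remove x (insert x P ∩ᵇ Q) ⟩
  𝟙 (insert x P x ∧ Q x) + count (remove x (insert x P ∩ᵇ Q))
    ≡⟨ cong₂ (λ b m → 𝟙 (b ∧ Q x) + m) (insert-self x P) (count-cong (remove-cong x insert-off-x)) ⟩
  𝟙 (Q x) + count (remove x (P ∩ᵇ Q))
    ≡⟨ cong (λ b → 𝟙 (Q x) + (𝟙 (b ∧ Q x) + count (remove x (P ∩ᵇ Q)))) (sym Px) ⟩
  𝟙 (Q x) + (𝟙 (P x ∧ Q x) + count (remove x (P ∩ᵇ Q))) ≡⟨ cong (𝟙 (Q x) +_) (sym (count-remove x (P ∩ᵇ Q))) ⟩
  𝟙 (Q x) + count (P ∩ᵇ Q)                              ∎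
  where
    open ≡-Reasoning
    insert-off-x : ∀ v → ⌊ v ≟ x ⌋ ≡ false → (insert x P ∩ᵇ Q) v ≡ (P ∩ᵇ Q) v
    insert-off-x v v≢x rewrite v≢x = refl

count≥2⇒two-elements : ∀ (P : Subsetᵇ n) → 2 ≤ count P → ∃₂ λ x y → x ≢ y × P x ≡ true × P y ≡ true
count≥2⇒two-elements P 2≤count
  with x , Px ← count>0⇒nonempty P (≤-trans (s≤s z≤n) 2≤count)
  with y , Py ← count>0⇒nonempty (remove x P) (≤-pred (subst (2 ≤_) (count-remove-∈ P Px) 2≤count))
  = x , y , (λ x≡y → remove-≢ x P Py (sym x≡y)) , Px , remove-⊆ x P Py

colourClass : (Fin n → Fin k) → Subsetᵇ n → Fin k → ℕ
colourClass c P a = count (P ∩ᵇ λ v → ⌊ c v ≟ a ⌋)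

count≡∑colourClass : ∀ (c : Fin n → Fin k) P → count P ≡ ∑[ a < k ] colourClass c P a
count≡∑colourClass {k = k} c P = trans (sum-cong-≗ split) (∑-comm (λ v a → 𝟙 (P v ∧ ⌊ c v ≟ a ⌋)))
  where
    one-hot : ∀ (x : Fin k) → count (λ a → ⌊ x ≟ a ⌋) ≡ 1
    one-hot x = begin
      count (λ a → ⌊ x ≟ a ⌋)                      ≡⟨ count-remove x (λ a → ⌊ x ≟ a ⌋) ⟩
      𝟙 ⌊ x ≟ x ⌋ + count (remove x (λ a → ⌊ x ≟ a ⌋))
        ≡⟨ cong₂ (λ b m → 𝟙 b + m) (⌊x≟x⌋≡true x) (count-cong (remove-cong x off-x)) ⟩
      1 + count {k} (remove x (λ _ → false))          ≡⟨ cong suc (trans (count-cong remove-∅) (count-∅ {k})) ⟩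
      1                                               ∎
      where
        open ≡-Reasoning
        remove-∅ : ∀ a → remove x (λ _ → false) a ≡ false
        remove-∅ a with ⌊ a ≟ x ⌋
        ... | true  = refl
        ... | false = refl
        off-x : ∀ a → ⌊ a ≟ x ⌋ ≡ false → ⌊ x ≟ a ⌋ ≡ false
        off-x a a≢x = x≢y⇒⌊x≟y⌋≡false (λ x≡a → ⌊x≟y⌋≡false⇒x≢y a≢x (sym x≡a))
    split : ∀ v → 𝟙 (P v) ≡ ∑[ a < k ] 𝟙 (P v ∧ ⌊ c v ≟ a ⌋)
    split v with P v
    ... | true  = sym (one-hot (c v))
    ... | false = sym (trans (sum-const k 0) (*-zeroʳ k))

pigeonhole : ∀ (c : Fin n → Fin k) (P : Subsetᵇ n) → k < count P →
             ∃₂ λ x y → x ≢ y × P x ≡ true × P y ≡ true × c x ≡ c y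
pigeonhole {k = k} c P k<count with any? (λ a → 2 ≤? colourClass c P a)
... | yes (a , 2≤class) with x , y , x≢y , x∈ , y∈ ← count≥2⇒two-elements _ 2≤class
  = x , y , x≢y , ∧-conicalˡ _ _ x∈ , ∧-conicalˡ _ _ y∈
  , trans (⌊x≟y⌋≡true⇒x≡y (∧-conicalʳ _ _ x∈)) (sym (⌊x≟y⌋≡true⇒x≡y (∧-conicalʳ _ _ y∈)))
... | no ¬class≥2 = ⊥-elim (<⇒≱ k<count (begin
  count P                         ≡⟨ count≡∑colourClass c P ⟩
  ∑[ a < k ] colourClass c P a    ≤⟨ sum-mono-≤ (λ a → ≤-pred (≰⇒> (λ 2≤class → ¬class≥2 (a , 2≤class)))) ⟩
  ∑[ a < k ] 1                    ≡⟨ trans (sum-const k 1) (*-identityʳ k) ⟩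
  k                               ∎))
  where open ≤-Reasoning

-- Disjoint sets with the same colouring

record Twins {n k : ℕ} (c : Fin n → Fin k) : Set where
  field
    X Y           : Subsetᵇ n
    disjoint      : Disjointᵇ X Y
    sameColouring : ∀ a → colourClass c X a ≡ colourClass c Y a

  count-X≡count-Y : count X ≡ count Y
  count-X≡count-Y = trans (count≡∑colourClass c X) (trans (sum-cong-≗ sameColouring) (sym (count≡∑colourClass c Y)))

  partner : ∀ {x} → X x ≡ true → ∃ λ y → Y y ≡ true × c y ≡ c x
  partner {x} x∈X
    with y , y∈ ← count>0⇒nonempty (Y ∩ᵇ λ v → ⌊ c v ≟ c x ⌋)
                    (subst (0 <_) (sameColouring (c x))
                      (∈⇒count>0 (X ∩ᵇ λ v → ⌊ c v ≟ c x ⌋) (cong₂ _∧_ x∈X (⌊x≟x⌋≡true (c x)))))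
    = y , ∧-conicalˡ _ _ y∈ , ⌊x≟y⌋≡true⇒x≡y (∧-conicalʳ _ _ y∈)

  uncovered : Subsetᵇ n
  uncovered = not ∘ (X ∪ᵇ Y)

  count-uncovered : 2 * count X + count uncovered ≡ n
  count-uncovered = begin
    2 * count X + count uncovered                ≡⟨ cong (λ m → m + count uncovered) 2|X|≡|X|+|Y| ⟩
    count X + count Y + count uncovered          ≡⟨ cong (_+ count uncovered) (count-∪ disjoint) ⟩
    count (X ∪ᵇ Y) + count uncovered             ≡⟨ count-complement (X ∪ᵇ Y) ⟩
    n                                            ∎
    where
      open ≡-Reasoning
      2|X|≡|X|+|Y| : 2 * count X ≡ count X + count Y
      2|X|≡|X|+|Y| = trans (cong (count X +_) (+-identityʳ (count X))) (cong (count X +_) count-X≡count-Y)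

extend : ∀ {n k} {c : Fin n → Fin k} (t : Twins c) → k < count (Twins.uncovered t) →
         Σ (Twins c) λ t′ → count (Twins.X t′) ≡ suc (count (Twins.X t))
extend {c = c} t k<|uncovered|
  with x , y , x≢y , x∉ , y∉ , cx≡cy ← pigeonhole c (Twins.uncovered t) k<|uncovered|
  = record { X = insert x X ; Y = insert y Y
           ; disjoint = insert-disjoint disjoint x≢y (proj₁ (outside y∉)) (proj₂ (outside x∉))
           ; sameColouring = sameColouring′ }
  , count-insert-∉ X (proj₁ (outside x∉))
  where
    open Twins t
    outside : ∀ {a b} → not (a ∨ b) ≡ true → a ≡ false × b ≡ false
    outside {false} {false} _ = refl , refl
    sameColouring′ : ∀ a → colourClass c (insert x X) a ≡ colourClass c (insert y Y) a
    sameColouring′ a = begin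
      colourClass c (insert x X) a           ≡⟨ count-∩-insert X _ (proj₁ (outside x∉)) ⟩
      𝟙 ⌊ c x ≟ a ⌋ + colourClass c X a      ≡⟨ cong₂ (λ z m → 𝟙 ⌊ z ≟ a ⌋ + m) cx≡cy (sameColouring a) ⟩
      𝟙 ⌊ c y ≟ a ⌋ + colourClass c Y a      ≡⟨ sym (count-∩-insert Y _ (proj₂ (outside y∉))) ⟩
      colourClass c (insert y Y) a           ∎
      where open ≡-Reasoning

remove-pair : ∀ {n k} {c : Fin n → Fin k} (t : Twins c) {x y} →
              Twins.X t x ≡ true → Twins.Y t y ≡ true → c y ≡ c x → Twins c
remove-pair {c = c} t {x} {y} x∈X y∈Y cy≡cx = record
  { X = remove x X ; Y = remove y Y
  ; disjoint = Disjoint-⊆ (remove-⊆ x X) (remove-⊆ y Y) disjoint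
  ; sameColouring = λ a → +-cancelˡ-≡ (𝟙 ⌊ c x ≟ a ⌋) _ _ (begin
      𝟙 ⌊ c x ≟ a ⌋ + colourClass c (remove x X) a  ≡⟨ sym (count-∩-remove X _ x∈X) ⟩
      colourClass c X a                             ≡⟨ sameColouring a ⟩
      colourClass c Y a                             ≡⟨ count-∩-remove Y _ y∈Y ⟩
      𝟙 ⌊ c y ≟ a ⌋ + colourClass c (remove y Y) a  ≡⟨ cong (λ z → 𝟙 ⌊ z ≟ a ⌋ + colourClass c (remove y Y) a) cy≡cx ⟩
      𝟙 ⌊ c x ≟ a ⌋ + colourClass c (remove y Y) a  ∎) }
  where
    open Twins t
    open ≡-Reasoning

swap : ∀ {n k} {c : Fin n → Fin k} → Twins c → Twins c
swap t = record
  { X = Y ; Y = X ; disjoint = λ v → trans (∧-comm (Y v) (X v)) (disjoint v) ; sameColouring = λ a → sym (sameColouring a) }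
  where open Twins t

twins-of-size : ∀ {n k} (c : Fin n → Fin k) i → 2 * i + k ≤ n → Σ (Twins c) λ t → count (Twins.X t) ≡ i
twins-of-size {n} c zero _ = record
  { X = λ _ → false ; Y = λ _ → false ; disjoint = λ _ → refl ; sameColouring = λ _ → refl } , count-∅ {n}
twins-of-size {n} {k} c (suc i) 2[1+i]+k≤n
  with t , refl ← twins-of-size c i (≤-trans (+-monoˡ-≤ k (*-monoʳ-≤ 2 (n≤1+n i))) 2[1+i]+k≤n)
  = extend t (+-cancelˡ-≤ (2 * i) _ _ (begin
      2 * i + suc k                       ≤⟨ ≤-trans (+-monoʳ-≤ (2 * i) (n≤1+n (suc k))) (≤-reflexive (rearrange i k)) ⟩
      2 * suc i + k                       ≤⟨ 2[1+i]+k≤n ⟩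
      n                                   ≡⟨ sym (Twins.count-uncovered t) ⟩
      2 * i + count (Twins.uncovered t)   ∎))
  where
    open ≤-Reasoning
    rearrange : ∀ i k → 2 * i + suc (suc k) ≡ 2 * suc i + k
    rearrange = solve-∀

-- Pruning vertices of low degree

degᵇ : ∀ {n} → Graph n → Subsetᵇ n → Fin n → ℕ
degᵇ G U v = count (U ∩ᵇ adj G v)

degᵇ-mono : ∀ {n} (G : Graph n) {U U′ : Subsetᵇ n} → U′ ⊆ᵇ U → ∀ v → degᵇ G U′ v ≤ degᵇ G U v
degᵇ-mono G {U} {U′} U′⊆U v = count-mono {P = U′ ∩ᵇ adj G v} {U ∩ᵇ adj G v}
  (λ w∈ → cong₂ _∧_ (U′⊆U (∧-conicalˡ _ _ w∈)) (∧-conicalʳ _ _ w∈))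

Sparse : ∀ {n} → Graph n → ℕ → Subsetᵇ n → Subsetᵇ n → Set
Sparse G D T U = ∀ {v} → T v ≡ true → degᵇ G U v < D

module Pruning {n k} (c : Fin n → Fin k) (G : Graph n) (D τ L p : ℕ) (0<τ : 0 < τ) (L+2τ≤p : L + 2 * τ ≤ p)
  (sparse⇒small : ∀ T U → Disjointᵇ T U → Sparse G D T U → L < count U → count T < τ) where

  record State : Set where
    field
      twins             : Twins c
      droppedX droppedY : Subsetᵇ n
    open Twins twins
    field
      droppedX-disjoint : Disjointᵇ droppedX X
      droppedY-disjoint : Disjointᵇ droppedY Y
      droppedX-sparse   : Sparse G D droppedX X
      droppedY-sparse   : Sparse G D droppedY Y
      droppedX-small    : count droppedX < τ
      droppedY-small    : count droppedY < τ
      total             : count X + count droppedX + count droppedY ≡ p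

  size : State → ℕ
  size st = count (Twins.X (State.twins st))

  record Pruned : Set where
    field
      twins   : Twins c
    open Twins twins
    field
      large   : L < count X
      small   : count X ≤ p
      X-dense : ∀ {v} → X v ≡ true → D ≤ degᵇ G X v
      Y-dense : ∀ {v} → Y v ≡ true → D ≤ degᵇ G Y v

  L<remaining : ∀ {s b₁ b₂} → s + b₁ + b₂ ≡ p → b₁ ≤ τ → b₂ < τ → L < s
  L<remaining {s} {b₁} {b₂} s+b₁+b₂≡p b₁≤τ b₂<τ = +-cancelʳ-< (2 * τ) L s (begin-strict
    L + 2 * τ      ≤⟨ L+2τ≤p ⟩
    p              ≡⟨ sym s+b₁+b₂≡p ⟩
    s + b₁ + b₂    <⟨ +-mono-≤-< (+-monoʳ-≤ s b₁≤τ) b₂<τ ⟩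
    s + τ + τ      ≡⟨ rearrange s τ ⟩
    s + 2 * τ      ∎)
    where
      open ≤-Reasoning
      rearrange : ∀ s τ → s + τ + τ ≡ s + 2 * τ
      rearrange = solve-∀

  start : (t : Twins c) → count (Twins.X t) ≡ p → State
  start t |X|≡p = record
    { twins = t ; droppedX = λ _ → false ; droppedY = λ _ → false
    ; droppedX-disjoint = λ _ → refl ; droppedY-disjoint = λ _ → refl
    ; droppedX-sparse = λ () ; droppedY-sparse = λ ()
    ; droppedX-small = subst (_< τ) (sym (count-∅ {n})) 0<τ ; droppedY-small = subst (_< τ) (sym (count-∅ {n})) 0<τ
    ; total = trans (cong₂ (λ a b → count (Twins.X t) + a + b) (count-∅ {n}) (count-∅ {n}))
                    (trans (+-identityʳ _) (trans (+-identityʳ _) |X|≡p)) }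

  swapState : State → State
  swapState st = record
    { twins = swap twins ; droppedX = droppedY ; droppedY = droppedX
    ; droppedX-disjoint = droppedY-disjoint ; droppedY-disjoint = droppedX-disjoint
    ; droppedX-sparse = droppedY-sparse ; droppedY-sparse = droppedX-sparse
    ; droppedX-small = droppedY-small ; droppedY-small = droppedX-small
    ; total = trans (rearrange (count Y) (count droppedY) (count droppedX))
                    (trans (cong (λ m → m + count droppedX + count droppedY) (sym count-X≡count-Y)) total) }
    where
      open State st
      open Twins twins
      rearrange : ∀ a b c → a + b + c ≡ a + c + b
      rearrange = solve-∀

  -- The dropped set stays below τ by sparse⇒small, since the remaining X is still larger than L.
  remove-sparse : ∀ (st : State) {x} → Twins.X (State.twins st) x ≡ true → degᵇ G (Twins.X (State.twins st)) x < D →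
                  Σ State λ st′ → size st′ < size st
  remove-sparse st {x} x∈X x-sparse with y , y∈Y , cy≡cx ← Twins.partner (State.twins st) x∈X
    = st′ , ≤-reflexive (sym |X|≡1+|X′|)
    where
      open State st
      open Twins twins
      X′ = remove x X
      droppedX′ = insert x droppedX
      |X|≡1+|X′| : count X ≡ suc (count X′)
      |X|≡1+|X′| = count-remove-∈ X x∈X
      x∉droppedX : droppedX x ≡ false
      x∉droppedX = trans (sym (∧-identityʳ (droppedX x))) (trans (cong (droppedX x ∧_) (sym x∈X)) (droppedX-disjoint x))
      droppedX′-sparse : Sparse G D droppedX′ X′
      droppedX′-sparse {v} v∈ with insert⁻ droppedX v∈
      ... | inj₁ refl = ≤-<-trans (degᵇ-mono G (remove-⊆ x X) x) x-sparse
      ... | inj₂ v∈droppedX = ≤-<-trans (degᵇ-mono G (remove-⊆ x X) v) (droppedX-sparse v∈droppedX)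
      total′ : count X′ + count droppedX′ + count droppedY ≡ p
      total′ = begin
        count X′ + count droppedX′ + count droppedY
          ≡⟨ cong (λ b → count X′ + b + count droppedY) (count-insert-∉ droppedX x∉droppedX) ⟩
        count X′ + suc (count droppedX) + count droppedY
          ≡⟨ cong (_+ count droppedY) (+-suc (count X′) (count droppedX)) ⟩
        suc (count X′) + count droppedX + count droppedY
          ≡⟨ cong (λ s → s + count droppedX + count droppedY) (sym |X|≡1+|X′|) ⟩
        count X + count droppedX + count droppedY
          ≡⟨ total ⟩
        p ∎
        where open ≡-Reasoning
      st′ : State
      st′ = record
        { twins = remove-pair twins x∈X y∈Y cy≡cx ; droppedX = droppedX′ ; droppedY = droppedY
        ; droppedX-disjoint = insert-remove-disjoint x droppedX-disjoint
        ; droppedY-disjoint = Disjoint-⊆ (λ v∈ → v∈) (remove-⊆ y Y) droppedY-disjoint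
        ; droppedX-sparse = droppedX′-sparse
        ; droppedY-sparse = λ v∈ → ≤-<-trans (degᵇ-mono G (remove-⊆ y Y) _) (droppedY-sparse v∈)
        ; droppedX-small = sparse⇒small droppedX′ X′ (insert-remove-disjoint x droppedX-disjoint) droppedX′-sparse
            (L<remaining total′ (≤-trans (≤-reflexive (count-insert-∉ droppedX x∉droppedX)) droppedX-small) droppedY-small)
        ; droppedY-small = droppedY-small
        ; total = total′ }

  sparse-vertex? : (U : Subsetᵇ n) → Dec (∃ λ v → U v ≡ true × degᵇ G U v < D)
  sparse-vertex? U = any? (λ v → (U v Bool.≟ true) ×-dec (degᵇ G U v <? D))

  no-sparse⇒dense : ∀ {U} → ¬ (∃ λ v → U v ≡ true × degᵇ G U v < D) → ∀ {v} → U v ≡ true → D ≤ degᵇ G U v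
  no-sparse⇒dense no-sparse {v} v∈U = ≮⇒≥ (λ v-sparse → no-sparse (v , v∈U , v-sparse))

  X⟨_⟩ Y⟨_⟩ : State → Subsetᵇ n
  X⟨ st ⟩ = Twins.X (State.twins st)
  Y⟨ st ⟩ = Twins.Y (State.twins st)

  prune : ∀ m (st : State) → size st ≤ m → Pruned
  prune m st size≤m with sparse-vertex? X⟨ st ⟩
  prune zero    st size≤0 | yes (x , x∈X , _) = ⊥-elim (<⇒≱ (∈⇒count>0 X⟨ st ⟩ x∈X) size≤0)
  prune (suc m) st size≤m | yes (x , x∈X , x-sparse)
    with st′ , shrunk ← remove-sparse st x∈X x-sparse = prune m st′ (≤-pred (≤-trans shrunk size≤m))
  prune m st size≤m | no no-sparse-X with sparse-vertex? Y⟨ st ⟩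
  prune zero    st size≤0 | no _ | yes (y , y∈Y , _) =
    ⊥-elim (<⇒≱ (∈⇒count>0 Y⟨ st ⟩ y∈Y) (subst (_≤ 0) (Twins.count-X≡count-Y (State.twins st)) size≤0))
  prune (suc m) st size≤m | no _ | yes (y , y∈Y , y-sparse)
    with st′ , shrunk ← remove-sparse (swapState st) y∈Y y-sparse =
    prune m st′ (≤-pred (≤-trans shrunk (subst (_≤ suc m) (Twins.count-X≡count-Y (State.twins st)) size≤m)))
  prune m st size≤m | no no-sparse-X | no no-sparse-Y = record
    { twins = twins
    ; large = L<remaining total (<⇒≤ droppedX-small) droppedY-small
    ; small = ≤-trans (m≤m+n _ _) (≤-trans (m≤m+n _ _) (≤-reflexive total))
    ; X-dense = no-sparse⇒dense no-sparse-X
    ; Y-dense = no-sparse⇒dense no-sparse-Y }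
    where open State st

-- Edges between sets and property (P2)

mem-tabulate : ∀ {n} (P : Subsetᵇ n) v → mem (tabulate P) v ≡ P v
mem-tabulate P v = lookup∘tabulate P v

∣tabulate∣≡count : ∀ {n} (P : Subsetᵇ n) → ∣ tabulate P ∣ ≡ count P
∣tabulate∣≡count {zero}  P = refl
∣tabulate∣≡count {suc n} P with P zero
... | true  = cong suc (∣tabulate∣≡count (P ∘ suc))
... | false = ∣tabulate∣≡count (P ∘ suc)

Disjoint-tabulate : ∀ {n} {P Q : Subsetᵇ n} → Disjointᵇ P Q → Disjoint (tabulate P) (tabulate Q)
Disjoint-tabulate {P = P} {Q} disjoint (v , v∈P∩Q) = true≢false (begin
  true                                           ≡⟨ sym ([]=⇒lookup v∈P∩Q) ⟩
  lookup (zipWith _∧_ (tabulate P) (tabulate Q)) v ≡⟨ lookup-zipWith _∧_ v (tabulate P) (tabulate Q) ⟩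
  mem (tabulate P) v ∧ mem (tabulate Q) v        ≡⟨ cong₂ _∧_ (mem-tabulate P v) (mem-tabulate Q v) ⟩
  P v ∧ Q v                                      ≡⟨ disjoint v ⟩
  false                                          ∎)
  where
    open ≡-Reasoning
    true≢false : true ≢ false
    true≢false ()

degIn-tabulate : ∀ {n} (G : Graph n) (U : Subsetᵇ n) v → degIn G (tabulate U) v ≡ degᵇ G U v
degIn-tabulate G U v = trans (countF≡count (λ w → mem (tabulate U) w ∧ adj G v w))
  (count-cong (λ w → cong (_∧ adj G v w) (mem-tabulate U w)))

colourCount-tabulate : ∀ {n k} (c : Fin n → Fin k) (P : Subsetᵇ n) a → colourCount c (tabulate P) a ≡ colourClass c P a
colourCount-tabulate c P a = trans (countF≡count (λ v → mem (tabulate P) v ∧ ⌊ c v ≟ a ⌋))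
  (count-cong (λ v → cong (_∧ ⌊ c v ≟ a ⌋) (mem-tabulate P v)))

eBetween-tabulate : ∀ {n} (G : Graph n) (T U : Subsetᵇ n) →
                    eBetween G (tabulate T) (tabulate U) ≡ ∑[ u < n ] count (λ w → T u ∧ U w ∧ adj G u w)
eBetween-tabulate G T U =
  trans (sumF≡sum (λ u → countF (λ w → mem (tabulate T) u ∧ mem (tabulate U) w ∧ adj G u w)))
    (sum-cong-≗ λ u → trans (countF≡count (λ w → mem (tabulate T) u ∧ mem (tabulate U) w ∧ adj G u w))
      (count-cong λ w → cong₂ (λ a b → a ∧ b ∧ adj G u w) (mem-tabulate T u) (mem-tabulate U w)))

eBetween≤ : ∀ {n} (G : Graph n) {T U : Subsetᵇ n} D₀ → (∀ {u} → T u ≡ true → degᵇ G U u ≤ D₀) →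
            eBetween G (tabulate T) (tabulate U) ≤ D₀ * count T
eBetween≤ {n} G {T} {U} D₀ T-sparse = begin
  eBetween G (tabulate T) (tabulate U)             ≡⟨ eBetween-tabulate G T U ⟩
  ∑[ u < n ] count (λ w → T u ∧ U w ∧ adj G u w)   ≤⟨ sum-mono-≤ edges-at ⟩
  ∑[ u < n ] (D₀ * 𝟙 (T u))                        ≡⟨ sym (*-distribˡ-sum D₀ (𝟙 ∘ T)) ⟩
  D₀ * count T                                     ∎
  where
    open ≤-Reasoning
    edges-at : ∀ u → count (λ w → T u ∧ U w ∧ adj G u w) ≤ D₀ * 𝟙 (T u)
    edges-at u with T u in u∈T
    ... | true  = ≤-trans (T-sparse u∈T) (≤-reflexive (sym (*-identityʳ D₀)))
    ... | false = ≤-trans (≤-reflexive (count-∅ {n})) z≤n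

-- (P2) bounds e(T,U) from below by |T||U|d/(20n), while each vertex of T contributes at most D₀ edges.
P2⇒sparse-bound : ∀ {n d} (G : Graph n) → P2 G d → ∀ {T U : Subsetᵇ n} D₀ → Disjointᵇ T U →
                  (∀ {u} → T u ≡ true → degᵇ G U u ≤ D₀) → 0 < count T →
                  LogLE d (count T * d) (10 * n) → LogLE d (count U * d) (100 * n) → count U * d ≤ 20 * n * D₀
P2⇒sparse-bound {n} {d} G p2 {T} {U} D₀ disjoint T-sparse 0<|T| T-large U-large =
  *-cancelˡ-≤ (count T) {{>-nonZero 0<|T|}} (begin
    count T * (count U * d)              ≡⟨ sym (*-assoc (count T) (count U) d) ⟩
    count T * count U * d                ≡⟨ cong₂ (λ t u → t * u * d) (sym (∣tabulate∣≡count T)) (sym (∣tabulate∣≡count U)) ⟩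
    ∣ tabulate T ∣ * ∣ tabulate U ∣ * d  ≤⟨ p2 (tabulate T) (tabulate U) (Disjoint-tabulate disjoint)
                                              (subst (λ t → LogLE d (t * d) (10 * n)) (sym (∣tabulate∣≡count T)) T-large)
                                              (subst (λ u → LogLE d (u * d) (100 * n)) (sym (∣tabulate∣≡count U)) U-large) ⟩
    20 * n * eBetween G (tabulate T) (tabulate U)  ≤⟨ *-monoʳ-≤ (20 * n) (eBetween≤ G D₀ T-sparse) ⟩
    20 * n * (D₀ * count T)              ≡⟨ x∙yz≈z∙xy (20 * n) D₀ (count T) ⟩
    count T * (20 * n * D₀)              ∎)
  where open ≤-Reasoning

-- Choice of parameters

log₂-bracket : ∀ d → ∃ λ J → 2 ^ J ≤ suc d × suc d ≤ 2 ^ suc J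
log₂-bracket zero = 0 , ≤-refl , s≤s z≤n
log₂-bracket (suc d) with log₂-bracket d
... | J , 2^J≤1+d , 1+d≤2^[1+J] with 2 + d ≤? 2 ^ suc J
...   | yes 2+d≤2^[1+J] = J , ≤-trans 2^J≤1+d (n≤1+n _) , 2+d≤2^[1+J]
...   | no  2+d≰2^[1+J] = suc J , ≤-trans (≤-pred (≰⇒> 2+d≰2^[1+J])) (n≤1+n _) , (begin
  2 + d                   ≤⟨ +-monoʳ-≤ 1 1+d≤2^[1+J] ⟩
  1 + 2 ^ suc J           ≤⟨ +-monoˡ-≤ (2 ^ suc J) (m^n>0 2 (suc J)) ⟩
  2 ^ suc J + 2 ^ suc J   ≡⟨ cong (2 ^ suc J +_) (sym (+-identityʳ (2 ^ suc J))) ⟩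
  2 ^ suc (suc J)         ∎)
  where open ≤-Reasoning

m<[1+m/q]*q : ∀ m q .{{_ : NonZero q}} → m < suc (m / q) * q
m<[1+m/q]*q m q = begin-strict
  m                  ≡⟨ m≡m%n+[m/n]*n m q ⟩
  m % q + m / q * q  <⟨ +-monoˡ-< (m / q * q) (m%n<n m q) ⟩
  q + m / q * q      ∎
  where open ≤-Reasoning

[1+m/q]*q≤m+q : ∀ m q .{{_ : NonZero q}} → suc (m / q) * q ≤ m + q
[1+m/q]*q≤m+q m q = ≤-trans (+-monoʳ-≤ q (m/n*n≤m m q)) (≤-reflexive (+-comm q m))

6[1+J]a+480[1+J]+100≤7Ja : ∀ a J → 1172 ≤ a → 11 ≤ J → 6 * suc J * a + 480 * suc J + 100 ≤ 7 * J * a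
6[1+J]a+480[1+J]+100≤7Ja a J 1172≤a 11≤J =
  subst (λ J → 6 * suc J * a + 480 * suc J + 100 ≤ 7 * J * a) (m+[n∸m]≡n 11≤J) (begin
    6 * suc (11 + j) * a + 480 * suc (11 + j) + 100
      ≡⟨ rearrange₁ a j ⟩
    6 * (12 + j) * a + (5860 + 480 * j)
      ≤⟨ +-monoʳ-≤ (6 * (12 + j) * a) (+-mono-≤ (*-monoʳ-≤ 5 1172≤a) (*-monoˡ-≤ j (≤-trans (≤ᵇ⇒≤ 480 1172 _) 1172≤a))) ⟩
    6 * (12 + j) * a + (5 * a + a * j)
      ≡⟨ rearrange₂ a j ⟩
    7 * (11 + j) * a ∎)
  where
    open ≤-Reasoning
    j = J ∸ 11
    rearrange₁ : ∀ a j → 6 * suc (11 + j) * a + 480 * suc (11 + j) + 100 ≡ 6 * (12 + j) * a + (5860 + 480 * j)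
    rearrange₁ = solve-∀
    rearrange₂ : ∀ a j → 6 * (12 + j) * a + (5 * a + a * j) ≡ 7 * (11 + j) * a
    rearrange₂ = solve-∀

size-upper-bound : ∀ {a J n d L τ} → 1172 ≤ a → 11 ≤ J → 1 ≤ n → d ≤ n →
  4 * d * L ≤ suc J * (a * n) + 4 * d → τ * d ≤ suc J * (10 * n) + d →
  12 * (2 * d * (L + 2 * τ)) + 28 ≤ 7 * (J * (a * n))
size-upper-bound {a} {J} {n} {d} {L} {τ} 1172≤a 11≤J 1≤n d≤n 4dL≤ τd≤ = begin
    12 * (2 * d * (L + 2 * τ)) + 28
      ≡⟨ rearrange₁ d L τ ⟩
    6 * (4 * d * L) + 48 * (τ * d) + 28
      ≤⟨ +-monoˡ-≤ 28 (+-mono-≤ (*-monoʳ-≤ 6 4dL≤) (*-monoʳ-≤ 48 τd≤)) ⟩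
    6 * (suc J * (a * n) + 4 * d) + 48 * (suc J * (10 * n) + d) + 28
      ≡⟨ rearrange₂ a J n d ⟩
    (6 * suc J * a + 480 * suc J) * n + (72 * d + 28)
      ≤⟨ +-monoʳ-≤ ((6 * suc J * a + 480 * suc J) * n) (+-mono-≤ (*-monoʳ-≤ 72 d≤n) (*-monoʳ-≤ 28 1≤n)) ⟩
    (6 * suc J * a + 480 * suc J) * n + (72 * n + 28 * n)
      ≡⟨ rearrange₃ a J n ⟩
    (6 * suc J * a + 480 * suc J + 100) * n
      ≤⟨ *-monoˡ-≤ n (6[1+J]a+480[1+J]+100≤7Ja a J 1172≤a 11≤J) ⟩
    7 * J * a * n
      ≡⟨ rearrange₄ a J n ⟩
    7 * (J * (a * n))  ∎
    where
      open ≤-Reasoning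
      rearrange₁ : ∀ d L τ → 12 * (2 * d * (L + 2 * τ)) + 28 ≡ 6 * (4 * d * L) + 48 * (τ * d) + 28
      rearrange₁ = solve-∀
      rearrange₂ : ∀ a J n d → 6 * (suc J * (a * n) + 4 * d) + 48 * (suc J * (10 * n) + d) + 28
                               ≡ (6 * suc J * a + 480 * suc J) * n + (72 * d + 28)
      rearrange₂ = solve-∀
      rearrange₃ : ∀ a J n → (6 * suc J * a + 480 * suc J) * n + (72 * n + 28 * n) ≡ (6 * suc J * a + 480 * suc J + 100) * n
      rearrange₃ = solve-∀
      rearrange₄ : ∀ a J n → 7 * J * a * n ≡ 7 * (J * (a * n))
      rearrange₄ = solve-∀

DenseTwins : ∀ {n k} → Graph n → ℕ → (Fin n → Fin k) → Set
DenseTwins {n} G d c = Σ (Subset n) λ V₁ → Σ (Subset n) λ V₂ →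
  Disjoint V₁ V₂ × Dense G d V₁ × Dense G d V₂ × SameColouring c V₁ V₂

module Construction {n} (d J : ℕ) (2^J≤d : 2 ^ J ≤ d) (d≤2^[1+J] : d ≤ 2 ^ suc J) (4096≤d : 4096 ≤ d) (d≤n : d ≤ n) where

  instance
    d≢0 : NonZero d
    d≢0 = >-nonZero (≤-trans (s≤s z≤n) 4096≤d)
    4d≢0 : NonZero (4 * d)
    4d≢0 = m*n≢0 4 d

  1≤n : 1 ≤ n
  1≤n = ≤-trans (≤-trans (s≤s z≤n) 4096≤d) d≤n

  11≤J : 11 ≤ J
  11≤J = ≤-pred (≮⇒≥ λ 1+J<12 → <⇒≱ (^-monoʳ-< 2 ≤-refl 1+J<12) (≤-trans 4096≤d d≤2^[1+J]))

  -- τ and L are the least integers with 10(1+J)n < τd and (1+J)αn < 4dL: with log d read as 1 + J,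
  -- just above the size thresholds of (P2) and of density. p = L + 2τ leaves room for the < 2τ
  -- vertices lost in pruning, and 1 + D₀ is the degree threshold 625(1+J) + 1.
  τ L p D₀ : ℕ
  τ = suc (suc J * (10 * n) / d)
  L = suc (suc J * (α * n) / (4 * d))
  p = L + 2 * τ
  D₀ = 625 * suc J

  [1+J]10n<τd : suc J * (10 * n) < τ * d
  [1+J]10n<τd = m<[1+m/q]*q (suc J * (10 * n)) d

  [1+J]αn<4dL : suc J * (α * n) < 4 * d * L
  [1+J]αn<4dL = <-≤-trans (m<[1+m/q]*q (suc J * (α * n)) (4 * d)) (≤-reflexive (*-comm L (4 * d)))

  [1+J]100n<Ld : suc J * (100 * n) < L * d
  [1+J]100n<Ld = *-cancelˡ-< 4 _ _ (begin-strict
    4 * (suc J * (100 * n))  ≡⟨ rearrange₁ J n ⟩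
    400 * (suc J * n)        ≤⟨ *-monoˡ-≤ (suc J * n) (≤ᵇ⇒≤ 400 α _) ⟩
    α * (suc J * n)          ≡⟨ rearrange₂ α J n ⟩
    suc J * (α * n)          <⟨ [1+J]αn<4dL ⟩
    4 * d * L                ≡⟨ rearrange₃ d L ⟩
    4 * (L * d)              ∎)
    where
      open ≤-Reasoning
      rearrange₁ : ∀ J n → 4 * (suc J * (100 * n)) ≡ 400 * (suc J * n)
      rearrange₁ = solve-∀
      rearrange₂ : ∀ a J n → a * (suc J * n) ≡ suc J * (a * n)
      rearrange₂ = solve-∀
      rearrange₃ : ∀ d L → 4 * d * L ≡ 4 * (L * d)
      rearrange₃ = solve-∀

  20n[1+D₀]≤Ld : 20 * n * suc D₀ ≤ L * d
  20n[1+D₀]≤Ld = <⇒≤ (*-cancelˡ-< 4 _ _ (begin-strict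
    4 * (20 * n * suc D₀)                      ≡⟨ rearrange₁ J n ⟩
    80 * n + 50000 * (suc J * n)
      ≤⟨ +-monoˡ-≤ (50000 * (suc J * n)) (*-mono-≤ (≤ᵇ⇒≤ 80 50000 _) (m≤n*m n (suc J))) ⟩
    50000 * (suc J * n) + 50000 * (suc J * n)  ≡⟨ rearrange₂ J n ⟩
    suc J * (α * n)                            <⟨ [1+J]αn<4dL ⟩
    4 * d * L                                  ≡⟨ rearrange₃ d L ⟩
    4 * (L * d)                                ∎))
    where
      open ≤-Reasoning
      rearrange₁ : ∀ J n → 4 * (20 * n * suc (625 * suc J)) ≡ 80 * n + 50000 * (suc J * n)
      rearrange₁ = solve-∀
      rearrange₂ : ∀ J n → 50000 * (suc J * n) + 50000 * (suc J * n) ≡ suc J * (α * n)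
      rearrange₂ = solve-∀
      rearrange₃ : ∀ d L → 4 * d * L ≡ 4 * (L * d)
      rearrange₃ = solve-∀

  24dp+28≤7Jαn : 12 * (2 * d * p) + 28 ≤ 7 * (J * (α * n))
  24dp+28≤7Jαn = size-upper-bound (≤ᵇ⇒≤ 1172 α _) 11≤J 1≤n d≤n
    (≤-trans (≤-reflexive (*-comm (4 * d) L)) ([1+m/q]*q≤m+q (suc J * (α * n)) (4 * d)))
    ([1+m/q]*q≤m+q (suc J * (10 * n)) d)

  LogLE-above : ∀ {a B} → suc J * B < a → LogLE d a B
  LogLE-above = ≤2^⇒LogLE J d≤2^[1+J]

  LogGE-below : ∀ {a B} → 12 * a + 28 ≤ 7 * (J * B) → LogGE d a B
  LogGE-below = 2^≤⇒LogGE J 2^J≤d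

  2p+k≤n : ∀ {k} → k ≤ n → LogLE d ((n ∸ k) * d) (α * n) → 2 * p + k ≤ n
  2p+k≤n {k} k≤n d^αn≤e^[n-k]d = begin
    2 * p + k  ≤⟨ +-monoˡ-≤ k (*-cancelʳ-≤ (2 * p) (n ∸ k) d 2pd≤[n-k]d) ⟩
    n ∸ k + k  ≡⟨ m∸n+n≡m k≤n ⟩
    n          ∎
    where
      open ≤-Reasoning
      2pd≤[n-k]d : 2 * p * d ≤ (n ∸ k) * d
      2pd≤[n-k]d = ≤-trans (≤-reflexive (xy∙z≈xz∙y 2 p d))
        (LogGE∧LogLE⇒≤ (≤-trans (≤ᵇ⇒≤ 2 4096 _) 4096≤d) (≤-trans 1≤n (m≤n*m n α))
          (LogGE-below 24dp+28≤7Jαn) d^αn≤e^[n-k]d)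

  sparse⇒small : (G : Graph n) → P2 G d → ∀ T U → Disjointᵇ T U → Sparse G (suc D₀) T U → L < count U → count T < τ
  sparse⇒small G p2 T U disjoint T-sparse L<|U| = ≰⇒> λ τ≤|T| → <⇒≱ (begin-strict
      20 * n * D₀        <⟨ m<n+m (20 * n * D₀) (≤-trans (s≤s z≤n) (*-monoʳ-≤ 20 1≤n)) ⟩
      20 * n + 20 * n * D₀ ≡⟨ sym (*-suc (20 * n) D₀) ⟩
      20 * n * suc D₀    ≤⟨ 20n[1+D₀]≤Ld ⟩
      L * d              ≤⟨ *-monoˡ-≤ d (<⇒≤ L<|U|) ⟩
      count U * d        ∎)
    (P2⇒sparse-bound G p2 D₀ disjoint (≤-pred ∘ T-sparse) (≤-trans (s≤s z≤n) τ≤|T|)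
      (LogLE-above (<-≤-trans [1+J]10n<τd (*-monoˡ-≤ d τ≤|T|)))
      (LogLE-above (<-≤-trans [1+J]100n<Ld (*-monoˡ-≤ d (<⇒≤ L<|U|)))))
    where open ≤-Reasoning

  Dense-tabulate : (G : Graph n) (U : Subsetᵇ n) → L < count U → count U ≤ p →
          (∀ {v} → U v ≡ true → suc D₀ ≤ degᵇ G U v) → Dense G d (tabulate U)
  Dense-tabulate G U L<|U| |U|≤p U-dense
    = subst (λ u → LogLE d (4 * d * u) (α * n)) |U|≡∣U∣
        (LogLE-above {4 * d * count U} {α * n} (<-≤-trans [1+J]αn<4dL (*-monoʳ-≤ (4 * d) (<⇒≤ L<|U|))))
    , subst (λ u → LogGE d (2 * d * u) (α * n)) |U|≡∣U∣
        (LogGE-below {2 * d * count U} {α * n} (≤-trans (+-monoˡ-≤ 28 (*-monoʳ-≤ 12 (*-monoʳ-≤ (2 * d) |U|≤p))) 24dp+28≤7Jαn))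
    , λ v v∈U → subst (λ m → LogLE d m 625) (sym (degIn-tabulate G U v))
        (LogLE-above {degᵇ G U v} {625} (<-≤-trans (s≤s (≤-reflexive (*-comm (suc J) 625)))
          (U-dense (trans (sym (mem-tabulate U v)) v∈U))))
    where
      |U|≡∣U∣ : count U ≡ ∣ tabulate U ∣
      |U|≡∣U∣ = sym (∣tabulate∣≡count U)

  dense-twins : (G : Graph n) → P2 G d → ∀ {k} → k ≤ n → LogLE d ((n ∸ k) * d) (α * n) → (c : Fin n → Fin k) →
                DenseTwins G d c
  dense-twins G p2 {k} k≤n d^αn≤e^[n-k]d c = prune-twins (twins-of-size c p (2p+k≤n k≤n d^αn≤e^[n-k]d))
    where
      open Pruning c G (suc D₀) τ L p (s≤s z≤n) ≤-refl (sparse⇒small G p2)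
      prune-twins : Σ (Twins c) (λ t → count (Twins.X t) ≡ p) → DenseTwins G d c
      prune-twins (t , |X|≡p) =
        tabulate X , tabulate Y , Disjoint-tabulate disjoint
        , Dense-tabulate G X large small X-dense
        , Dense-tabulate G Y (subst (L <_) count-X≡count-Y large) (subst (_≤ p) count-X≡count-Y small) Y-dense
        , λ a → trans (colourCount-tabulate c X a) (trans (sameColouring a) (sym (colourCount-tabulate c Y a)))
        where
          open Pruned (prune p (start t |X|≡p) (≤-reflexive |X|≡p))
          open Twins twins

dense-twins : ∀ d → 4096 ≤ d → ∀ {n} → d ≤ n → (G : Graph n) → P2 G d →
              ∀ {k} → k ≤ n → LogLE d ((n ∸ k) * d) (α * n) → (c : Fin n → Fin k) → DenseTwins G d c
dense-twins (suc d) 4096≤d d≤n G p2 k≤n d^αn≤e^[n-k]d c =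
  let J , 2^J≤d , d≤2^[1+J] = log₂-bracket d
  in Construction.dense-twins (suc d) J 2^J≤d d≤2^[1+J] 4096≤d d≤n G p2 k≤n d^αn≤e^[n-k]d c

lemma5 : Σ ℕ (λ d₀ → (d : ℕ) → d₀ ≤ d → Σ ℕ (λ n₀ → (n : ℕ) → n₀ ≤ n →
           (G : Graph n) → Regular G d → P1 G d → P2 G d →
           (k : ℕ) → k ≤ n → LogLE d ((n ∸ k) * d) (α * n) →
           (c : Fin n → Fin k) →
           Σ (Subset n) (λ V₁ → Σ (Subset n) (λ V₂ →
             Disjoint V₁ V₂ × Dense G d V₁ × Dense G d V₂ × SameColouring c V₁ V₂))))
lemma5 = 4096 , λ d 4096≤d → d , λ n d≤n G _ _ p2 k k≤n d^αn≤e^[n-k]d c →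
  dense-twins d 4096≤d d≤n G p2 k≤n d^αn≤e^[n-k]d c
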